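{- As $q$ runs through the primes in increasing order, the sequence $d(q)$ is strictly decreasing and $d(q)\to 0$ as $q \to \infty$.
   Context: Tower factorization: the tower factorization of $1$ is $1$; if $n>1$ has prime factorization $n=p_1^{e_1}\cdots p_k^{e_k}$, its tower factorization is $\prod_{i=1}^k p_i^{(f_i)}$ where $f_i$ is the tower factorization of $e_i$ (recursively). A prime $q$ is contained in the tower factorization of $n$ if $q$ appears as one of the primes at any level of this recursive representation. For a prime $q$, $M(q)$ is the set of positive integers whose tower factorization contains $q$ (with $1\notin M(q)$). $d(q) := \lim_{N\to\infty} |M(q)\cap\{1,\ldots,N\}|/N$ (this limit exists). -}

module Defs where

open import Data.Nat using (ℕ; zero; suc; _+_; _*_; _∸_; _≤_; _<_; _%_; _/_)
open import Data.Nat.Properties using (_≟_)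
open import Data.Nat.Primality using (Prime; prime?)
open import Data.Bool using (Bool; true; false; _∧_; _∨_; if_then_else_)
open import Data.List using (List; []; _∷_; upTo; map)
open import Data.Bool.ListAction using (any)
open import Relation.Nullary using (does)

-- p-adic valuation v_p(n) for p ≥ 2 and n ≥ 1, computed with fuel
-- (fuel n suffices since v_p(n) ≤ n). Returns 0 for n = 0 or p < 2.
valFuel : ℕ → ℕ → ℕ → ℕ
valFuel zero p n = 0
valFuel (suc f) (suc (suc k)) (suc m) with does ((suc m) % (suc (suc k)) ≟ 0)
... | true  = suc (valFuel f (suc (suc k)) ((suc m) / (suc (suc k))))
... | false = 0
valFuel (suc f) _ _ = 0

val : ℕ → ℕ → ℕ
val p n = valFuel n p n

candidates : ℕ → List ℕ
candidates n = map (λ i → i + 2) (upTo (n ∸ 1))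

-- containsFuel f q n : does the tower factorization of n contain the prime q?
-- n = ∏ p^{e_p}; q is contained iff q = p for some p with e_p ≥ 1, or q is
-- contained in the tower factorization of some exponent e_p (recursively).
-- The tower factorization of 1 (and the exponent-1 case) contains no prime.
-- Exponents e_p < n for n ≥ 2, so fuel n suffices.
containsFuel : ℕ → ℕ → ℕ → Bool
containsFuel zero q n = false
containsFuel (suc f) q n =
  any (λ p → does (prime? p) ∧ does (1 Data.Nat.≤? val p n)
               ∧ (does (p ≟ q) ∨ containsFuel f q (val p n)))
      (candidates n)

inM : ℕ → ℕ → Bool
inM q n = containsFuel n q n

countM : ℕ → ℕ → ℕ
countM q zero = 0
countM q (suc N) = countM q N + (if inM q (suc N) then 1 else 0)

-- d(p) > d(q): there is a rational ε = (suc a)/(suc b) > 0 such that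
-- eventually countM p N / N ≥ countM q N / N + ε.
-- (Given that both densities exist, this is equivalent to d(p) > d(q).)
DensityGreater : ℕ → ℕ → Set
DensityGreater p q =
  Data.Product.Σ ℕ λ a → Data.Product.Σ ℕ λ b → Data.Product.Σ ℕ λ N₀ →
    (N : ℕ) → N₀ ≤ N → suc b * countM q N + suc a * N ≤ suc b * countM p N
  where import Data.Product

{-# OPTIONS --safe #-}
-- Fix primes p < q and let ψ replace q by p at every level of the tower factorisation. On numbers
-- outside M(p) the map ψ does not increase n, is injective (the exponent of p in ψ n records the
-- exponent of q in n) and sends M(q) \ M(p) into M(p) \ M(q). Its image misses the numbers p k with
-- N/q < k ≤ N/p and k prime to p q and free of q-th powers r^q (r ≠ p): they lie in M(p) \ M(q), but
-- an image of p-valuation 1 is at most p N / q. A sieve finds at least N / (96 p q) such k for large N,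
-- which separates the counts of M(p) and M(q) by a positive proportion of N.
-- For the limit, n ∈ M(q) forces q ∣ n or r^q ∣ n for some r ≥ 2, and 1/q + Σ_{r ≥ 2} 1/r^q → 0.
module Submission where

open import Defs
open import Data.Nat using (ℕ; suc; _+_; _*_; _≤_; _<_)
open import Data.Nat.Primality using (Prime)
open import Data.Product using (Σ; _×_)

open import Data.Bool using (Bool; true; false; T; not; _∧_; _∨_; if_then_else_)
open import Data.Bool.ListAction using (or)
open import Data.Bool.Properties using (T-∧; T-∨; ∧-comm)
open import Data.Empty using (⊥; ⊥-elim)
open import Data.List using (List; []; _∷_; map; length; _++_)
open import Data.List.Membership.Propositional using (_∈_; find; lose; _─_)
open import Data.List.Membership.Propositional.Properties using (∈-map⁺; ∈-map⁻; ∈-upTo⁺; ∈-++⁻)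
open import Data.List.Properties using (map-cong; length-removeAt′; length-++; length-map)
open import Data.List.Relation.Binary.Disjoint.Propositional using (Disjoint)
open import Data.List.Relation.Binary.Subset.Propositional using (_⊆_)
import Data.List.Relation.Unary.All as All
import Data.List.Relation.Unary.All.Properties as All
open import Data.List.Relation.Unary.AllPairs using ([]; _∷_)
open import Data.List.Relation.Unary.Any using (here; there; index)
open import Data.List.Relation.Unary.Any.Properties using (any⁺; any⁻)
open import Data.List.Relation.Unary.Unique.Propositional using (Unique)
import Data.List.Relation.Unary.Unique.Propositional.Properties as Unique
open import Data.Nat
open import Data.Nat.Divisibility
open import Data.Nat.DivMod
open import Data.Nat.Induction using (<-rec)
open import Data.Nat.ListAction using (product)
open import Data.Nat.Primality
open import Data.Nat.Primality.Factorisation using (factorise)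
open import Data.Nat.Properties
open import Data.Nat.Tactic.RingSolver using (solve-∀)
open import Data.Product using (∃-syntax; _,_; proj₁; proj₂)
open import Data.Sum using (_⊎_; inj₁; inj₂)
import Data.Sum as Sum
open import Data.Unit using (tt)
open import Function using (id; _∘′_; _$_)
open import Function.Bundles using (Equivalence)
open import Relation.Binary.Definitions using (tri<; tri≈; tri>)
open import Relation.Binary.PropositionalEquality
open import Relation.Nullary
open import Relation.Nullary.Decidable using (dec-true; dec-false)

+-right-comm : ∀ a b c → a + b + c ≡ a + c + b
+-right-comm = solve-∀

*-right-comm : ∀ a b c → a * b * c ≡ a * c * b
*-right-comm = solve-∀

^-monoʳ-∣ : ∀ p {a b} → a ≤ b → p ^ a ∣ p ^ b
^-monoʳ-∣ p {a} {b} a≤b = divides (p ^ (b ∸ a)) (begin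
  p ^ b                 ≡⟨ cong (p ^_) (sym (m+[n∸m]≡n a≤b)) ⟩
  p ^ (a + (b ∸ a))     ≡⟨ ^-distribˡ-+-* p a (b ∸ a) ⟩
  p ^ a * p ^ (b ∸ a)   ≡⟨ *-comm (p ^ a) (p ^ (b ∸ a)) ⟩
  p ^ (b ∸ a) * p ^ a   ∎)
  where open ≡-Reasoning

^>0 : ∀ {p} e → 0 < p → 0 < p ^ e
^>0 {p} e p>0 = m^n>0 p {{>-nonZero p>0}} e

n<m^n : ∀ {m} n → 1 < m → n < m ^ n
n<m^n zero _ = s≤s z≤n
n<m^n {m} (suc n) 1<m = begin-strict
  suc n             <⟨ s≤s (n<m^n n 1<m) ⟩
  suc (m ^ n)       ≤⟨ +-monoˡ-≤ (m ^ n) (^>0 n (<-trans (s≤s z≤n) 1<m)) ⟩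
  m ^ n + m ^ n     ≡⟨ cong (m ^ n +_) (sym (+-identityʳ (m ^ n))) ⟩
  2 * m ^ n         ≤⟨ *-monoˡ-≤ (m ^ n) 1<m ⟩
  m * m ^ n         ∎
  where open ≤-Reasoning

m<n*[1+m/n] : ∀ m n .{{_ : NonZero n}} → m < n * suc (m / n)
m<n*[1+m/n] m n = begin-strict
  m                   ≡⟨ m≡m%n+[m/n]*n m n ⟩
  m % n + m / n * n   <⟨ +-monoˡ-< (m / n * n) (m%n<n m n) ⟩
  n + m / n * n       ≡⟨ cong (n +_) (*-comm (m / n) n) ⟩
  n + n * (m / n)     ≡⟨ sym (*-suc n (m / n)) ⟩
  n * suc (m / n)     ∎
  where open ≤-Reasoning

∣⇒≤′ : ∀ {m n} → 0 < n → m ∣ n → m ≤ n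
∣⇒≤′ n>0 = ∣⇒≤ {{>-nonZero n>0}}

prime⇒1< : ∀ {p} → Prime p → 1 < p
prime⇒1< {p} pr = nonTrivial⇒n>1 p {{prime⇒nonTrivial pr}}

prime⇒0< : ∀ {p} → Prime p → 0 < p
prime⇒0< pr = <-trans (s≤s z≤n) (prime⇒1< pr)

prime∣prime⇒≡ : ∀ {p r} → Prime p → Prime r → p ∣ r → p ≡ r
prime∣prime⇒≡ pp pr p∣r with prime⇒irreducible pr p∣r
... | inj₂ p≡r = p≡r
... | inj₁ refl = ⊥-elim (¬prime[1] pp)

prime∣^⇒≡ : ∀ {p r} e → Prime p → Prime r → p ∣ r ^ e → p ≡ r
prime∣^⇒≡ zero pp pr p∣1 = ⊥-elim (¬prime[1] (subst Prime (∣1⇒≡1 p∣1) pp))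
prime∣^⇒≡ {r = r} (suc e) pp pr p∣r^1+e with euclidsLemma r (r ^ e) pp p∣r^1+e
... | inj₁ p∣r = prime∣prime⇒≡ pp pr p∣r
... | inj₂ p∣r^e = prime∣^⇒≡ e pp pr p∣r^e

prime-factor : ∀ {n} → 1 < n → ∃[ r ] Prime r × r ∣ n
prime-factor {n} 1<n with factorise n {{>-nonZero (<-trans (s≤s z≤n) 1<n)}}
... | record { factors = [] ; isFactorisation = n≡1 } = ⊥-elim (<⇒≢ 1<n (sym n≡1))
... | record { factors = r ∷ rs ; isFactorisation = eq ; factorsPrime = pr All.∷ _ } =
  r , pr , divides (product rs) (trans eq (*-comm r (product rs)))

-- p-adic valuations

private
  valFuel-spec : ∀ f k n → 0 < n → n ≤ f →
    let p = suc (suc k) in p ^ valFuel f p n ∣ n × ¬ (p ^ suc (valFuel f p n) ∣ n)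
  valFuel-spec (suc f) k (suc m) _ (s≤s n≤f) with (suc m % suc (suc k)) ≡ᵇ 0 in p∣?n
  ... | false = divides (suc m) (sym (*-identityʳ (suc m))) ,
                λ (p^1∣n : suc (suc k) * 1 ∣ suc m) → p∤n (subst (_∣ suc m) (*-identityʳ _) p^1∣n)
    where
    p∤n : ¬ (suc (suc k) ∣ suc m)
    p∤n p∣n with () ← subst (λ r → (r ≡ᵇ 0) ≡ false) (n∣m⇒m%n≡0 (suc m) (suc (suc k)) p∣n) p∣?n
  ... | true = p^[1+v]∣n , p^[2+v]∤n
    where
    p = suc (suc k)
    n′ = suc m / p
    n≡n′*p : suc m ≡ n′ * p
    n≡n′*p = trans (m≡m%n+[m/n]*n (suc m) p) (cong (_+ n′ * p) (≡ᵇ⇒≡ _ 0 (subst T (sym p∣?n) tt)))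
    n′>0 : 0 < n′
    n′>0 with n′ | n≡n′*p
    ... | suc _ | _ = s≤s z≤n
    n′<n : n′ < suc m
    n′<n = subst (n′ <_) (sym n≡n′*p) (m<m*n n′ p {{>-nonZero n′>0}} (s≤s (s≤s z≤n)))
    ih = valFuel-spec f k n′ n′>0 (≤-trans (≤-pred n′<n) n≤f)
    v = valFuel f p n′
    p^[1+v]∣n : p * p ^ v ∣ suc m
    p^[1+v]∣n = subst₂ _∣_ (*-comm (p ^ v) p) (sym n≡n′*p) (*-pres-∣ (proj₁ ih) (∣-refl {p}))
    p^[2+v]∤n : ¬ (p * (p * p ^ v) ∣ suc m)
    p^[2+v]∤n d = proj₂ ih (*-cancelʳ-∣ p (subst₂ _∣_ (*-comm p (p * p ^ v)) n≡n′*p d))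

  val-spec : ∀ {p n} → 1 < p → 0 < n → p ^ val p n ∣ n × ¬ (p ^ suc (val p n) ∣ n)
  val-spec {suc (suc k)} {n} _ n>0 = valFuel-spec n k n n>0 ≤-refl
  val-spec {1} (s≤s ())

p^val∣n : ∀ {p n} → 1 < p → 0 < n → p ^ val p n ∣ n
p^val∣n 1<p n>0 = proj₁ (val-spec 1<p n>0)

p^[1+val]∤n : ∀ {p n} → 1 < p → 0 < n → ¬ (p ^ suc (val p n) ∣ n)
p^[1+val]∤n 1<p n>0 = proj₂ (val-spec 1<p n>0)

val-unique : ∀ {p n e} → 1 < p → 0 < n → p ^ e ∣ n → ¬ (p ^ suc e ∣ n) → val p n ≡ e
val-unique {p} {n} {e} 1<p n>0 p^e∣n p^[1+e]∤n with <-cmp (val p n) e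
... | tri≈ _ v≡e _ = v≡e
... | tri< v<e _ _ = ⊥-elim (p^[1+val]∤n 1<p n>0 (∣-trans (^-monoʳ-∣ p v<e) p^e∣n))
... | tri> _ _ e<v = ⊥-elim (p^[1+e]∤n (∣-trans (^-monoʳ-∣ p e<v) (p^val∣n 1<p n>0)))

val<n : ∀ {p n} → 1 < p → 0 < n → val p n < n
val<n {p} {n} 1<p n>0 = <-≤-trans (n<m^n (val p n) 1<p) (∣⇒≤′ n>0 (p^val∣n 1<p n>0))

∣⇒val>0 : ∀ {p n} → 1 < p → 0 < n → p ∣ n → 0 < val p n
∣⇒val>0 {p} {n} 1<p n>0 p∣n with val p n in v≡
... | suc _ = s≤s z≤n
... | zero = ⊥-elim (p^[1+val]∤n 1<p n>0 (subst (λ v → p ^ suc v ∣ n) (sym v≡)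
                                             (subst (_∣ n) (sym (*-identityʳ p)) p∣n)))

val>0⇒∣ : ∀ {p n} → 1 < p → 0 < n → 0 < val p n → p ∣ n
val>0⇒∣ {p} {n} 1<p n>0 v>0 =
  subst (_∣ n) (*-identityʳ p) (∣-trans (^-monoʳ-∣ p v>0) (p^val∣n 1<p n>0))

val-1 : ∀ {p} → 1 < p → val p 1 ≡ 0
val-1 {p} 1<p = val-unique 1<p (s≤s z≤n) ∣-refl (λ p*1∣1 → <⇒≱ 1<p (∣⇒≤′ (s≤s z≤n) (m*n∣⇒m∣ p 1 p*1∣1)))

<⇒val≡0 : ∀ {p n} → 1 < p → 0 < n → n < p → val p n ≡ 0
<⇒val≡0 {p} {n} 1<p n>0 n<p with val p n in v≡
... | zero = refl
... | suc _ = ⊥-elim (<⇒≱ n<p (∣⇒≤′ n>0 (val>0⇒∣ 1<p n>0 (subst (0 <_) (sym v≡) (s≤s z≤n)))))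

val-decomposition : ∀ {p n} → 1 < p → 0 < n → ∃[ m ] n ≡ m * p ^ val p n × ¬ (p ∣ m)
val-decomposition {p} {n} 1<p n>0 with p^val∣n 1<p n>0
... | divides m n≡m*p^v = m , n≡m*p^v , λ { (divides c m≡c*p) → p^[1+val]∤n 1<p n>0
        (divides c (trans n≡m*p^v (trans (cong (_* p ^ val p n) m≡c*p) (reassoc c p (p ^ val p n))))) }
  where
  reassoc : ∀ a b c → a * b * c ≡ a * (b * c)
  reassoc = solve-∀

val-* : ∀ {p a b} → Prime p → 0 < a → 0 < b → val p (a * b) ≡ val p a + val p b
val-* {p} {a} {b} pp a>0 b>0 = val-unique 1<p (*-mono-≤ a>0 b>0) (divides (a′ * b′) ab≡) p^[1+u+v]∤ab
  where
  1<p = prime⇒1< pp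
  u = val p a
  v = val p b
  a′ = proj₁ (val-decomposition 1<p a>0)
  b′ = proj₁ (val-decomposition 1<p b>0)
  reassoc : ∀ a′ b′ x y → a′ * x * (b′ * y) ≡ a′ * b′ * (x * y)
  reassoc = solve-∀
  ab≡ : a * b ≡ (a′ * b′) * p ^ (u + v)
  ab≡ = begin
    a * b                              ≡⟨ cong₂ _*_ (proj₁ (proj₂ (val-decomposition 1<p a>0)))
                                                    (proj₁ (proj₂ (val-decomposition 1<p b>0))) ⟩
    a′ * p ^ u * (b′ * p ^ v)          ≡⟨ reassoc a′ b′ (p ^ u) (p ^ v) ⟩
    a′ * b′ * (p ^ u * p ^ v)          ≡⟨ cong (a′ * b′ *_) (sym (^-distribˡ-+-* p u v)) ⟩
    a′ * b′ * p ^ (u + v)              ∎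
    where open ≡-Reasoning
  p^[1+u+v]∤ab : ¬ (p ^ suc (u + v) ∣ a * b)
  p^[1+u+v]∤ab d with euclidsLemma a′ b′ pp (*-cancelʳ-∣ (p ^ (u + v)) {{>-nonZero (^>0 (u + v) (prime⇒0< pp))}}
                                                (subst (p * p ^ (u + v) ∣_) ab≡ d))
  ... | inj₁ p∣a′ = proj₂ (proj₂ (val-decomposition 1<p a>0)) p∣a′
  ... | inj₂ p∣b′ = proj₂ (proj₂ (val-decomposition 1<p b>0)) p∣b′

val-^ : ∀ {p} e → 1 < p → val p (p ^ e) ≡ e
val-^ {p} e 1<p = val-unique 1<p p^e>0 ∣-refl
  (λ d → <⇒≱ (^-monoʳ-< p 1<p (n<1+n e)) (∣⇒≤′ p^e>0 d))
  where p^e>0 = ^>0 e (<-trans (s≤s z≤n) 1<p)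

val-^-other : ∀ {p r} e → Prime p → Prime r → r ≢ p → val p (r ^ e) ≡ 0
val-^-other {p} {r} e pp pr r≢p = val-unique (prime⇒1< pp) (^>0 e (prime⇒0< pr)) (1∣ _)
  (λ d → r≢p (sym (prime∣^⇒≡ e pp pr (subst (_∣ r ^ e) (*-identityʳ p) d))))

val-injective : ∀ {a b} → 0 < a → 0 < b → (∀ s → Prime s → val s a ≡ val s b) → a ≡ b
val-injective {a} = <-rec (λ a → ∀ {b} → 0 < a → 0 < b → (∀ s → Prime s → val s a ≡ val s b) → a ≡ b) step a
  where
  step : ∀ a → (∀ {a′} → a′ < a → ∀ {b} → 0 < a′ → 0 < b → (∀ s → Prime s → val s a′ ≡ val s b) → a′ ≡ b) →
         ∀ {b} → 0 < a → 0 < b → (∀ s → Prime s → val s a ≡ val s b) → a ≡ b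
  step 1 _ {b} _ b>0 same with b ≤? 1
  ... | yes b≤1 = sym (≤-antisym b≤1 b>0)
  ... | no b≰1 with prime-factor (≰⇒> b≰1)
  ...   | s , ps , s∣b = ⊥-elim (<⇒≱ (∣⇒val>0 (prime⇒1< ps) b>0 s∣b)
                                     (≤-reflexive (trans (sym (same s ps)) (val-1 (prime⇒1< ps)))))
  step a@(suc (suc _)) rec {b} a>0 b>0 same with prime-factor {a} (s≤s (s≤s z≤n))
  ... | s , ps , s∣a = trans a≡s*a′ (trans (cong (s *_) a′≡b′) (sym b≡s*b′))
    where
    1<s = prime⇒1< ps
    s∣b = val>0⇒∣ 1<s b>0 (subst (0 <_) (same s ps) (∣⇒val>0 1<s a>0 s∣a))
    a′ = quotient s∣a
    b′ = quotient s∣b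
    a≡s*a′ : a ≡ s * a′
    a≡s*a′ = trans (_∣_.equality s∣a) (*-comm a′ s)
    b≡s*b′ : b ≡ s * b′
    b≡s*b′ = trans (_∣_.equality s∣b) (*-comm b′ s)
    cofactor>0 : ∀ {x y} → 0 < x → x ≡ s * y → 0 < y
    cofactor>0 {y = zero} x>0 x≡0 = ⊥-elim (<⇒≢ x>0 (sym (trans x≡0 (*-zeroʳ s))))
    cofactor>0 {y = suc _} _ _ = s≤s z≤n
    a′>0 = cofactor>0 a>0 a≡s*a′
    b′>0 = cofactor>0 b>0 b≡s*b′
    a′<a : a′ < a
    a′<a = subst (a′ <_) (sym a≡s*a′) (subst (_< s * a′) (*-identityˡ a′) (*-monoˡ-< a′ {{>-nonZero a′>0}} 1<s))
    same′ : ∀ t → Prime t → val t a′ ≡ val t b′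
    same′ t pt = +-cancelˡ-≡ (val t s) _ _ (begin
      val t s + val t a′   ≡⟨ sym (val-* pt (prime⇒0< ps) a′>0) ⟩
      val t (s * a′)       ≡⟨ cong (val t) (sym a≡s*a′) ⟩
      val t a              ≡⟨ same t pt ⟩
      val t b              ≡⟨ cong (val t) b≡s*b′ ⟩
      val t (s * b′)       ≡⟨ val-* pt (prime⇒0< ps) b′>0 ⟩
      val t s + val t b′   ∎)
      where open ≡-Reasoning
    a′≡b′ = rec a′<a a′>0 b′>0 same′

-- Tower factorisations

T-does⁻ : ∀ {P : Set} (P? : Dec P) → T (does P?) → P
T-does⁻ (yes p) _ = p

T-does⁺ : ∀ {P : Set} (P? : Dec P) → P → T (does P?)
T-does⁺ (yes _) _ = tt
T-does⁺ (no ¬p) p = ¬p p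

candidates-∈⁺ : ∀ {x n} → 1 < x → x ≤ n → x ∈ candidates n
candidates-∈⁺ {suc (suc i)} {suc n} (s≤s (s≤s z≤n)) (s≤s x≤n) =
  subst (_∈ candidates (suc n)) (+-comm i 2) (∈-map⁺ (_+ 2) (∈-upTo⁺ x≤n))

-- A record rather than T (inM q n), so that q and n can be inferred from membership proofs.
record InM (q n : ℕ) : Set where
  constructor ∈M
  field isInM : T (inM q n)

private
  witness? : ℕ → ℕ → ℕ → ℕ → Bool
  witness? f q n r = does (prime? r) ∧ does (1 ≤? val r n) ∧ (does (r ≟ q) ∨ containsFuel f q (val r n))

containsFuel-irrelevant : ∀ f g q n → n ≤ f → n ≤ g → containsFuel f q n ≡ containsFuel g q n
containsFuel-irrelevant zero    zero    q n       _ _ = refl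
containsFuel-irrelevant zero    (suc g) q zero    _ _ = refl
containsFuel-irrelevant (suc f) zero    q zero    _ _ = refl
containsFuel-irrelevant (suc f) (suc g) q zero    _ _ = refl
containsFuel-irrelevant (suc f) (suc g) q (suc m) (s≤s m≤f) (s≤s m≤g) =
  cong or (map-cong same (candidates (suc m)))
  where
  same : ∀ r → witness? f q (suc m) r ≡ witness? g q (suc m) r
  same r with prime? r
  ... | no _ = refl
  ... | yes pr = agree (val r (suc m)) (val<n (prime⇒1< pr) (s≤s z≤n))
    where
    agree : ∀ v → v < suc m → does (1 ≤? v) ∧ (does (r ≟ q) ∨ containsFuel f q v)
                             ≡ does (1 ≤? v) ∧ (does (r ≟ q) ∨ containsFuel g q v)
    agree zero    _         = refl
    agree (suc k) (s≤s v≤m) =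
      cong (does (r ≟ q) ∨_) (containsFuel-irrelevant f g q (suc k) (≤-trans v≤m m≤f) (≤-trans v≤m m≤g))

containsFuel≡inM : ∀ {f q n} → n ≤ f → containsFuel f q n ≡ inM q n
containsFuel≡inM {f} {q} {n} n≤f = containsFuel-irrelevant f n q n n≤f ≤-refl

InM⇒0< : ∀ {q n} → InM q n → 0 < n
InM⇒0< {n = suc _} _ = s≤s z≤n
InM⇒0< {n = zero} (∈M ())

0∉M : ∀ {q} → ¬ InM q 0
0∉M (∈M ())

InM⁻ : ∀ {q n} → InM q n → ∃[ r ] Prime r × r ∣ n × (r ≡ q ⊎ InM q (val r n))
InM⁻ {q} {suc m} (∈M q∈) with find (any⁻ (witness? m q (suc m)) (candidates (suc m)) q∈)
... | r , r∈ , w with Equivalence.to T-∧ w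
... | r-prime , w′ with Equivalence.to T-∧ w′
... | v>0 , r≡q⊎rec =
  r , pr , val>0⇒∣ (prime⇒1< pr) (s≤s z≤n) (T-does⁻ (1 ≤? val r (suc m)) v>0) ,
  Sum.map (T-does⁻ (r ≟ q)) recurse (Equivalence.to T-∨ r≡q⊎rec)
  where
  pr = T-does⁻ (prime? r) r-prime
  recurse : T (containsFuel m q (val r (suc m))) → InM q (val r (suc m))
  recurse = ∈M ∘′ subst T (containsFuel≡inM (≤-pred (val<n (prime⇒1< pr) (s≤s z≤n))))

InM⁺ : ∀ {q n r} → 0 < n → Prime r → r ∣ n → r ≡ q ⊎ InM q (val r n) → InM q n
InM⁺ {q} {suc m} {r} n>0 pr r∣n r≡q⊎rec = ∈M $
  any⁺ (witness? m q (suc m)) (lose (candidates-∈⁺ (prime⇒1< pr) (∣⇒≤′ n>0 r∣n)) w)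
  where
  v<n = val<n (prime⇒1< pr) n>0
  w : T (witness? m q (suc m) r)
  w = Equivalence.from T-∧ (T-does⁺ (prime? r) pr , Equivalence.from T-∧
        (T-does⁺ (1 ≤? val r (suc m)) (∣⇒val>0 (prime⇒1< pr) n>0 r∣n) , Equivalence.from T-∨
        (Sum.map (T-does⁺ (r ≟ q)) (subst T (sym (containsFuel≡inM (≤-pred v<n))) ∘′ InM.isInM) r≡q⊎rec)))

InM⇒≤ : ∀ {q n} → InM q n → q ≤ n
InM⇒≤ {q} {n} = <-rec (λ n → InM q n → q ≤ n) step n
  where
  step : ∀ n → (∀ {m} → m < n → InM q m → q ≤ m) → InM q n → q ≤ n
  step n rec q∈ with InM⁻ q∈
  ... | r , pr , r∣n , inj₁ refl = ∣⇒≤′ (InM⇒0< q∈) r∣n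
  ... | r , pr , r∣n , inj₂ q∈v = ≤-trans (rec v<n q∈v) (<⇒≤ v<n)
    where v<n = val<n (prime⇒1< pr) (InM⇒0< q∈)

InM⇒∣⊎^∣ : ∀ {q n} → InM q n → q ∣ n ⊎ ∃[ r ] 1 < r × r ≤ n × r ^ q ∣ n
InM⇒∣⊎^∣ {q} {n} q∈ with InM⁻ q∈
... | r , pr , r∣n , inj₁ refl = inj₁ r∣n
... | r , pr , r∣n , inj₂ q∈v = inj₂ (r , prime⇒1< pr , ∣⇒≤′ n>0 r∣n ,
                                     ∣-trans (^-monoʳ-∣ r (InM⇒≤ q∈v)) (p^val∣n (prime⇒1< pr) n>0))
  where n>0 = InM⇒0< q∈

-- Finite sums f 1 + ⋯ + f N and counting

sumTo : ℕ → (ℕ → ℕ) → ℕ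
sumTo zero    f = 0
sumTo (suc N) f = sumTo N f + f (suc N)

syntax sumTo N (λ n → e) = ∑[ n ≤ N ] e

𝟙 : Bool → ℕ
𝟙 b = if b then 1 else 0

countM≡∑ : ∀ q N → countM q N ≡ ∑[ n ≤ N ] 𝟙 (inM q n)
countM≡∑ q zero    = refl
countM≡∑ q (suc N) = cong (_+ 𝟙 (inM q (suc N))) (countM≡∑ q N)

sumTo-mono : ∀ {f g} N → (∀ n → 0 < n → n ≤ N → f n ≤ g n) → sumTo N f ≤ sumTo N g
sumTo-mono zero    f≤g = z≤n
sumTo-mono (suc N) f≤g =
  +-mono-≤ (sumTo-mono N (λ n n>0 n≤N → f≤g n n>0 (m≤n⇒m≤1+n n≤N))) (f≤g (suc N) (s≤s z≤n) ≤-refl)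

sumTo-cong : ∀ {f g} N → (∀ n → 0 < n → n ≤ N → f n ≡ g n) → sumTo N f ≡ sumTo N g
sumTo-cong N f≡g = ≤-antisym (sumTo-mono N (λ n a b → ≤-reflexive (f≡g n a b)))
                             (sumTo-mono N (λ n a b → ≤-reflexive (sym (f≡g n a b))))

sumTo-+ : ∀ f g N → ∑[ n ≤ N ] (f n + g n) ≡ sumTo N f + sumTo N g
sumTo-+ f g zero    = refl
sumTo-+ f g (suc N) rewrite sumTo-+ f g N = interchange (sumTo N f) (sumTo N g) (f (suc N)) (g (suc N))
  where
  interchange : ∀ a b c d → a + b + (c + d) ≡ a + c + (b + d)
  interchange = solve-∀

sumTo-* : ∀ c f N → ∑[ n ≤ N ] (c * f n) ≡ c * sumTo N f
sumTo-* c f zero    = sym (*-zeroʳ c)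
sumTo-* c f (suc N) rewrite sumTo-* c f N = sym (*-distribˡ-+ c (sumTo N f) (f (suc N)))

sumTo-zero : ∀ f N → (∀ n → 0 < n → n ≤ N → f n ≡ 0) → sumTo N f ≡ 0
sumTo-zero f zero    _   = refl
sumTo-zero f (suc N) f≡0 rewrite sumTo-zero f N (λ n a b → f≡0 n a (m≤n⇒m≤1+n b))
                               | f≡0 (suc N) (s≤s z≤n) ≤-refl = refl

sumTo-swap : ∀ (h : ℕ → ℕ → ℕ) N K → ∑[ n ≤ N ] sumTo K (h n) ≡ ∑[ r ≤ K ] ∑[ n ≤ N ] h n r
sumTo-swap h zero    K = sym (sumTo-zero (λ _ → 0) K (λ _ _ _ → refl))
sumTo-swap h (suc N) K rewrite sumTo-swap h N K = sym (sumTo-+ (λ r → ∑[ n ≤ N ] h n r) (h (suc N)) K)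

term≤sumTo : ∀ f N r → 0 < r → r ≤ N → f r ≤ sumTo N f
term≤sumTo f zero    (suc r) _ ()
term≤sumTo f (suc N) r r>0 r≤1+N with r ≟ suc N
... | yes refl = m≤n+m (f (suc N)) (sumTo N f)
... | no r≢1+N = ≤-trans (term≤sumTo f N r r>0 (≤-pred (≤∧≢⇒< r≤1+N r≢1+N))) (m≤m+n (sumTo N f) (f (suc N)))

sumTo-single : ∀ f s N → 0 < s → (∀ r → r ≢ s → f r ≡ 0) → (N < s → f s ≡ 0) → sumTo N f ≡ f s
sumTo-single f s zero    s>0 _    beyond = sym (beyond s>0)
sumTo-single f s (suc N) s>0 f≡0 beyond with suc N ≟ s
... | yes refl = cong (_+ f (suc N)) (sumTo-zero f N (λ r _ r≤N → f≡0 r (<⇒≢ (s≤s r≤N))))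
... | no  1+N≢s = trans (cong₂ _+_ (sumTo-single f s N s>0 f≡0 (λ N<s → beyond (≤∧≢⇒< N<s 1+N≢s)))
                                   (f≡0 (suc N) 1+N≢s))
                        (+-identityʳ _)

sumTo-pair : ∀ f s t N → 0 < s → 0 < t → s ≢ t → (∀ r → r ≢ s → r ≢ t → f r ≡ 0) →
  (N < s → f s ≡ 0) → (N < t → f t ≡ 0) → sumTo N f ≡ f s + f t
sumTo-pair f s t N s>0 t>0 s≢t f≡0 beyond-s beyond-t = begin
  sumTo N f                                    ≡⟨ sumTo-cong N (λ r _ _ → split r) ⟩
  ∑[ r ≤ N ] (only s r + only t r)             ≡⟨ sumTo-+ (only s) (only t) N ⟩
  sumTo N (only s) + sumTo N (only t)          ≡⟨ cong₂ _+_ (sumTo-single (only s) s N s>0 (only-off s) (trans (only-at s) ∘′ beyond-s))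
                                                            (sumTo-single (only t) t N t>0 (only-off t) (trans (only-at t) ∘′ beyond-t)) ⟩
  only s s + only t t                          ≡⟨ cong₂ _+_ (only-at s) (only-at t) ⟩
  f s + f t                                    ∎
  where
  open ≡-Reasoning
  only : ℕ → ℕ → ℕ
  only u r = 𝟙 (does (r ≟ u)) * f r
  only-at : ∀ u → only u u ≡ f u
  only-at u rewrite dec-true (u ≟ u) refl = +-identityʳ (f u)
  only-off : ∀ u r → r ≢ u → only u r ≡ 0
  only-off u r r≢u rewrite dec-false (r ≟ u) r≢u = refl
  split : ∀ r → f r ≡ only s r + only t r
  split r with r ≟ s | r ≟ t
  ... | yes refl | yes refl = ⊥-elim (s≢t refl)
  ... | yes refl | no r≢t   = sym (trans (cong₂ _+_ (only-at r) (only-off t r r≢t)) (+-identityʳ (f r)))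
  ... | no r≢s   | yes refl = sym (cong₂ _+_ (only-off s r r≢s) (only-at r))
  ... | no r≢s   | no r≢t   = trans (f≡0 r r≢s r≢t) (sym (cong₂ _+_ (only-off s r r≢s) (only-off t r r≢t)))

sumTo-monoˡ : ∀ f {M N} → M ≤ N → sumTo M f ≤ sumTo N f
sumTo-monoˡ f {M} {zero}  z≤n     = ≤-refl
sumTo-monoˡ f {M} {suc N} M≤1+N with M ≟ suc N
... | yes refl = ≤-refl
... | no M≢1+N = ≤-trans (sumTo-monoˡ f (≤-pred (≤∧≢⇒< M≤1+N M≢1+N))) (m≤m+n _ _)

sumTo-const : ∀ N → ∑[ _ ≤ N ] 1 ≡ N
sumTo-const zero    = refl
sumTo-const (suc N) = trans (+-comm (∑[ _ ≤ N ] 1) 1) (cong suc (sumTo-const N))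

sumBetween : ℕ → ℕ → (ℕ → ℕ) → ℕ
sumBetween X Y f = ∑[ n ≤ Y ] (𝟙 (does (X <? n)) * f n)

syntax sumBetween X Y (λ n → e) = ∑[ X < n ≤ Y ] e

sumBetween-split : ∀ f {X Y} → X ≤ Y → ∑[ X < n ≤ Y ] f n + sumTo X f ≡ sumTo Y f
sumBetween-split f {X} {Y} X≤Y = subst (λ Y → ∑[ X < n ≤ Y ] f n + sumTo X f ≡ sumTo Y f)
                                       (m+[n∸m]≡n X≤Y) (go (Y ∸ X))
  where
  go : ∀ d → ∑[ X < n ≤ X + d ] f n + sumTo X f ≡ sumTo (X + d) f
  go zero rewrite +-identityʳ X
    | sumTo-zero (λ n → 𝟙 (does (X <? n)) * f n) X
                 (λ n _ n≤X → cong (λ b → 𝟙 b * f n) (dec-false (X <? n) (≤⇒≯ n≤X))) = refl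
  go (suc d) rewrite +-suc X d | dec-true (X <? suc (X + d)) (s≤s (m≤m+n X d)) =
    trans (swap-last (∑[ X < n ≤ X + d ] f n) (sumTo X f) (f (suc (X + d))))
          (cong (_+ f (suc (X + d))) (go d))
    where
    swap-last : ∀ a b c → a + (c + 0) + b ≡ a + b + c
    swap-last = solve-∀

sumBetween-const : ∀ {X Y} → X ≤ Y → ∑[ X < _ ≤ Y ] 1 ≡ Y ∸ X
sumBetween-const {X} {Y} X≤Y = +-cancelʳ-≡ X _ _ (begin
  ∑[ X < _ ≤ Y ] 1 + X            ≡⟨ cong (∑[ X < _ ≤ Y ] 1 +_) (sym (sumTo-const X)) ⟩
  ∑[ X < _ ≤ Y ] 1 + ∑[ _ ≤ X ] 1 ≡⟨ sumBetween-split (λ _ → 1) X≤Y ⟩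
  ∑[ _ ≤ Y ] 1                    ≡⟨ sumTo-const Y ⟩
  Y                               ≡⟨ sym (m∸n+n≡m X≤Y) ⟩
  Y ∸ X + X                       ∎)
  where open ≡-Reasoning

multiples : ℕ → ℕ → ℕ
multiples d N = ∑[ n ≤ N ] 𝟙 (does (d ∣? n))

multiples-bounds : ∀ {d} N → 0 < d → d * multiples d N ≤ N × N < d * multiples d N + d
multiples-bounds {d} zero d>0 = ≤-reflexive (*-zeroʳ d) , subst (0 <_) (sym (cong (_+ d) (*-zeroʳ d))) d>0
multiples-bounds {d} (suc N) d>0 with multiples-bounds N d>0 | d ∣? suc N
... | (dD≤N , N<dD+d) | yes (divides k 1+N≡k*d) = ≤-reflexive d[D+1]≡1+N , subst (_< d * (D + 1) + d) d[D+1]≡1+N (m<m+n _ d>0)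
  where
  D = multiples d N
  k≡1+D : k ≡ suc D
  k≡1+D = ≤-antisym
    (*-cancelʳ-≤ k (suc D) d {{>-nonZero d>0}}
       (subst₂ _≤_ 1+N≡k*d (trans (+-comm (d * D) d) (cong (d +_) (*-comm d D))) N<dD+d))
    (*-cancelʳ-< _ D k (subst (D * d <_) 1+N≡k*d (subst (_< suc N) (*-comm d D) (s≤s dD≤N))))
  d[D+1]≡1+N : d * (D + 1) ≡ suc N
  d[D+1]≡1+N = trans (cong (d *_) (+-comm D 1)) (trans (*-comm d (suc D)) (trans (cong (_* d) (sym k≡1+D)) (sym 1+N≡k*d)))
... | (dD≤N , N<dD+d) | no d∤1+N =
  subst (λ z → d * z ≤ suc N) (sym (+-identityʳ D)) (m≤n⇒m≤1+n dD≤N) ,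
  subst (λ z → suc N < d * z + d) (sym (+-identityʳ D)) (≤∧≢⇒< N<dD+d 1+N≢dD+d)
  where
  D = multiples d N
  1+N≢dD+d : suc N ≢ d * D + d
  1+N≢dD+d 1+N≡ = d∤1+N (divides (suc D) (trans 1+N≡ (trans (+-comm (d * D) d) (cong (d +_) (*-comm d D)))))

multiples-between : ∀ {d X Y} → 0 < d → X ≤ Y → d * ∑[ X < n ≤ Y ] 𝟙 (does (d ∣? n)) ≤ (Y ∸ X) + d
multiples-between {d} {X} {Y} d>0 X≤Y = ≤-pred (+-cancelʳ-< X (d * c) (suc ((Y ∸ X) + d)) (begin-strict
  d * c + X                 <⟨ +-monoʳ-< (d * c) (proj₂ (multiples-bounds X d>0)) ⟩
  d * c + (d * DX + d)      ≡⟨ collect d c DX ⟩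
  d * (c + DX) + d          ≡⟨ cong (λ z → d * z + d) (sumBetween-split (λ n → 𝟙 (does (d ∣? n))) X≤Y) ⟩
  d * multiples d Y + d     ≤⟨ +-monoˡ-≤ d (proj₁ (multiples-bounds Y d>0)) ⟩
  Y + d                     ≡⟨ cong (_+ d) (sym (m∸n+n≡m X≤Y)) ⟩
  (Y ∸ X) + X + d           ≡⟨ +-right-comm (Y ∸ X) X d ⟩
  (Y ∸ X) + d + X           <⟨ n<1+n _ ⟩
  suc ((Y ∸ X) + d + X)     ∎))
  where
  open ≤-Reasoning
  c = ∑[ X < n ≤ Y ] 𝟙 (does (d ∣? n))
  DX = multiples d X
  collect : ∀ d c x → d * c + (d * x + d) ≡ d * (c + x) + d
  collect = solve-∀

-- Σ_{a < r ≤ K} M / (r (r - 1)) = M (1/a - 1/K), with the denominators cleared.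
telescoping-bound : ∀ (x : ℕ → ℕ) M a K → 0 < a → a ≤ K → (∀ r → r ≤ a → x r ≡ 0) →
  (∀ k → a ≤ k → x (suc k) * (suc k * k) ≤ M) → a * sumTo K x ≤ M
telescoping-bound x M a K a>0 a≤K x≡0 x-small = *-cancelʳ-≤ (a * sumTo K x) M K {{>-nonZero (≤-trans a>0 a≤K)}} (begin
  a * sumTo K x * K           ≡⟨ *-right-comm a (sumTo K x) K ⟩
  a * K * sumTo K x           ≤⟨ m≤m+n _ (a * M) ⟩
  a * K * sumTo K x + a * M   ≤⟨ subst (λ K → a * K * sumTo K x + a * M ≤ M * K) (m+[n∸m]≡n a≤K) (invariant (K ∸ a)) ⟩
  M * K                       ∎)
  where
  open ≤-Reasoning
  invariant : ∀ d → a * (a + d) * sumTo (a + d) x + a * M ≤ M * (a + d)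
  invariant zero rewrite +-identityʳ a | sumTo-zero x a (λ r _ r≤a → x≡0 r r≤a) | *-zeroʳ (a * a) = ≤-reflexive (*-comm a M)
  invariant (suc d) rewrite +-suc a d =
    *-cancelʳ-≤ _ _ K′ {{>-nonZero (≤-trans a>0 (m≤m+n a d))}} (+-cancelʳ-≤ (a * M) _ _ (begin
      (a * suc K′ * (S + x′) + a * M) * K′ + a * M   ≡⟨ expand a K′ S x′ M ⟩
      suc K′ * (a * K′ * S + a * M) + a * (x′ * (suc K′ * K′))
        ≤⟨ +-mono-≤ (*-monoʳ-≤ (suc K′) (invariant d)) (*-monoʳ-≤ a (x-small K′ (m≤m+n a d))) ⟩
      suc K′ * (M * K′) + a * M                        ≡⟨ cong (_+ a * M) (reorder (suc K′) M K′) ⟩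
      M * suc K′ * K′ + a * M                          ∎))
    where
    K′ = a + d
    S = sumTo K′ x
    x′ = x (suc K′)
    expand : ∀ a K S x′ M → (a * suc K * (S + x′) + a * M) * K + a * M
                           ≡ suc K * (a * K * S + a * M) + a * (x′ * (suc K * K))
    expand = solve-∀
    reorder : ∀ a b c → a * (b * c) ≡ b * a * c
    reorder = solve-∀

-- The densities tend to zero

countM≤multiples : ∀ q N → countM q N ≤ multiples q N + ∑[ r ≤ N ] (𝟙 (does (1 <? r)) * multiples (r ^ q) N)
countM≤multiples q N = begin
  countM q N                                                     ≡⟨ countM≡∑ q N ⟩
  ∑[ n ≤ N ] 𝟙 (inM q n)                                         ≤⟨ sumTo-mono N pointwise ⟩
  ∑[ n ≤ N ] (𝟙 (does (q ∣? n)) + ∑[ r ≤ N ] powerDivides r n)   ≡⟨ sumTo-+ _ _ N ⟩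
  multiples q N + ∑[ n ≤ N ] ∑[ r ≤ N ] powerDivides r n         ≡⟨ cong (multiples q N +_) (sumTo-swap (λ n r → powerDivides r n) N N) ⟩
  multiples q N + ∑[ r ≤ N ] ∑[ n ≤ N ] powerDivides r n         ≡⟨ cong (multiples q N +_) (sumTo-cong N (λ r _ _ →
                                                                      sumTo-* (𝟙 (does (1 <? r))) (λ n → 𝟙 (does (r ^ q ∣? n))) N)) ⟩
  multiples q N + ∑[ r ≤ N ] (𝟙 (does (1 <? r)) * multiples (r ^ q) N) ∎
  where
  open ≤-Reasoning
  powerDivides : ℕ → ℕ → ℕ
  powerDivides r n = 𝟙 (does (1 <? r)) * 𝟙 (does (r ^ q ∣? n))
  pointwise : ∀ n → 0 < n → n ≤ N → 𝟙 (inM q n) ≤ 𝟙 (does (q ∣? n)) + ∑[ r ≤ N ] powerDivides r n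
  pointwise n _ n≤N with inM q n in q∈?
  ... | false = z≤n
  ... | true with InM⇒∣⊎^∣ (∈M {q} {n} (subst T (sym q∈?) tt))
  ...   | inj₁ q∣n rewrite dec-true (q ∣? n) q∣n = s≤s z≤n
  ...   | inj₂ (r , 1<r , r≤n , r^q∣n) = ≤-trans
    (subst (_≤ ∑[ r ≤ N ] powerDivides r n) (cong₂ (λ a b → 𝟙 a * 𝟙 b) (dec-true (1 <? r) 1<r) (dec-true (r ^ q ∣? n) r^q∣n))
      (term≤sumTo (λ r → powerDivides r n) N r (<-trans (s≤s z≤n) 1<r) (≤-trans r≤n n≤N)))
    (m≤n+m _ _)

c*[1+K]*K≤[1+K]^q : ∀ c q K → c + 2 ≤ q → 0 < K → c * (suc K * K) ≤ suc K ^ q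
c*[1+K]*K≤[1+K]^q c q K c+2≤q K>0 = begin
  c * (suc K * K)                    ≤⟨ *-mono-≤ c≤[1+K]^[q-2] (*-monoʳ-≤ (suc K) (n≤1+n K)) ⟩
  suc K ^ (q ∸ 2) * (suc K * suc K)  ≡⟨ rearrange (suc K ^ (q ∸ 2)) (suc K) ⟩
  suc K ^ (2 + (q ∸ 2))              ≡⟨ cong (suc K ^_) (m+[n∸m]≡n (≤-trans (m≤n+m 2 c) c+2≤q)) ⟩
  suc K ^ q                          ∎
  where
  open ≤-Reasoning
  rearrange : ∀ a r → a * (r * r) ≡ r * (r * a)
  rearrange = solve-∀
  c≤[1+K]^[q-2] : c ≤ suc K ^ (q ∸ 2)
  c≤[1+K]^[q-2] = ≤-trans (<⇒≤ (n<m^n c ≤-refl)) (≤-trans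
    (^-monoʳ-≤ 2 (+-cancelʳ-≤ 2 c (q ∸ 2) (subst (c + 2 ≤_) (sym (m∸n+n≡m (≤-trans (m≤n+m 2 c) c+2≤q))) c+2≤q)))
    (^-monoˡ-≤ (q ∸ 2) (s≤s K>0)))

countM-small : ∀ c q N → 2 * c + 2 ≤ q → c * countM q N ≤ N
countM-small c q N 2c+2≤q = *-cancelˡ-≤ 2 (begin
  2 * (c * countM q N)                    ≡⟨ sym (*-assoc 2 c (countM q N)) ⟩
  2 * c * countM q N                      ≤⟨ *-monoʳ-≤ (2 * c) (countM≤multiples q N) ⟩
  2 * c * (multiples q N + powerSum)      ≡⟨ *-distribˡ-+ (2 * c) (multiples q N) powerSum ⟩
  2 * c * multiples q N + 2 * c * powerSum ≤⟨ +-mono-≤ primeTerm powerTerms ⟩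
  N + N                                   ≡⟨ cong (N +_) (sym (+-identityʳ N)) ⟩
  2 * N                                   ∎)
  where
  open ≤-Reasoning
  q>0 = ≤-trans (s≤s z≤n) (≤-trans (m≤n+m 2 (2 * c)) 2c+2≤q)
  x : ℕ → ℕ
  x r = 𝟙 (does (1 <? r)) * multiples (r ^ q) N
  powerSum = sumTo N x
  primeTerm : 2 * c * multiples q N ≤ N
  primeTerm = ≤-trans (*-monoˡ-≤ (multiples q N) (≤-trans (m≤m+n (2 * c) 2) 2c+2≤q)) (proj₁ (multiples-bounds N q>0))
  x-small : ∀ k → 1 ≤ k → 2 * c * x (suc k) * (suc k * k) ≤ N
  x-small k k>0 rewrite dec-true (1 <? suc k) (s≤s k>0) | +-identityʳ (multiples (suc k ^ q) N) = begin
    2 * c * m * (suc k * k)   ≡⟨ *-right-comm (2 * c) m (suc k * k) ⟩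
    2 * c * (suc k * k) * m   ≤⟨ *-monoˡ-≤ m (c*[1+K]*K≤[1+K]^q (2 * c) q k 2c+2≤q k>0) ⟩
    suc k ^ q * m             ≤⟨ proj₁ (multiples-bounds N (^>0 q (s≤s z≤n))) ⟩
    N                         ∎
    where m = multiples (suc k ^ q) N
  x≡0 : ∀ r → r ≤ 1 → 2 * c * x r ≡ 0
  x≡0 r r≤1 rewrite dec-false (1 <? r) (≤⇒≯ r≤1) = *-zeroʳ (2 * c)
  powerTerms : 2 * c * powerSum ≤ N
  powerTerms = begin
    2 * c * sumTo N x                    ≡⟨ sym (sumTo-* (2 * c) x N) ⟩
    ∑[ r ≤ N ] (2 * c * x r)             ≤⟨ sumTo-monoˡ (λ r → 2 * c * x r) (n≤1+n N) ⟩
    ∑[ r ≤ suc N ] (2 * c * x r)         ≡⟨ sym (*-identityˡ _) ⟩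
    1 * ∑[ r ≤ suc N ] (2 * c * x r)     ≤⟨ telescoping-bound (λ r → 2 * c * x r) N 1 (suc N) (s≤s z≤n) (s≤s z≤n) x≡0 x-small ⟩
    N                                    ∎

-- Rebuilding a number from its prime-power factors

prodTo : ℕ → (ℕ → ℕ) → ℕ
prodTo zero    g = 1
prodTo (suc n) g = prodTo n g * g (suc n)

syntax prodTo N (λ n → e) = ∏[ n ≤ N ] e

prodTo>0 : ∀ {g} n → (∀ r → 0 < g r) → 0 < prodTo n g
prodTo>0 zero    _   = ≤-refl
prodTo>0 (suc n) g>0 = *-mono-≤ (prodTo>0 n g>0) (g>0 (suc n))

val-prodTo : ∀ {s g} n → Prime s → (∀ r → 0 < g r) → val s (prodTo n g) ≡ ∑[ r ≤ n ] val s (g r)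
val-prodTo zero    ps _   = val-1 (prime⇒1< ps)
val-prodTo {s} {g} (suc n) ps g>0 =
  trans (val-* ps (prodTo>0 n g>0) (g>0 (suc n))) (cong (_+ val s (g (suc n))) (val-prodTo n ps g>0))

prodTo-mono : ∀ {g h} n → (∀ r → g r ≤ h r) → prodTo n g ≤ prodTo n h
prodTo-mono zero    _   = ≤-refl
prodTo-mono (suc n) g≤h = *-mono-≤ (prodTo-mono n g≤h) (g≤h (suc n))

prodTo-cong : ∀ {g h} n → (∀ r → 0 < r → r ≤ n → g r ≡ h r) → prodTo n g ≡ prodTo n h
prodTo-cong zero    _   = refl
prodTo-cong (suc n) g≡h = cong₂ _*_ (prodTo-cong n (λ r a b → g≡h r a (m≤n⇒m≤1+n b))) (g≡h (suc n) (s≤s z≤n) ≤-refl)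

prodTo-mono-at : ∀ {g h} n s c d → 0 < s → s ≤ n → (∀ r → g r ≤ h r) → c * g s ≤ d * h s →
  c * prodTo n g ≤ d * prodTo n h
prodTo-mono-at zero (suc s) c d _ () _ _
prodTo-mono-at {g} {h} (suc n) s c d s>0 s≤1+n g≤h at-s with s ≟ suc n
... | yes refl = begin
  c * (prodTo n g * g (suc n))   ≡⟨ x∙yz≈y∙xz c (prodTo n g) (g (suc n)) ⟩
  prodTo n g * (c * g (suc n))   ≤⟨ *-mono-≤ (prodTo-mono n g≤h) at-s ⟩
  prodTo n h * (d * h (suc n))   ≡⟨ sym (x∙yz≈y∙xz d (prodTo n h) (h (suc n))) ⟩
  d * (prodTo n h * h (suc n))   ∎
  where
  open ≤-Reasoning
  x∙yz≈y∙xz : ∀ a b c → a * (b * c) ≡ b * (a * c)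
  x∙yz≈y∙xz = solve-∀
... | no s≢1+n = begin
  c * (prodTo n g * g (suc n))   ≡⟨ sym (*-assoc c _ _) ⟩
  c * prodTo n g * g (suc n)     ≤⟨ *-mono-≤ (prodTo-mono-at n s c d s>0 (≤-pred (≤∧≢⇒< s≤1+n s≢1+n)) g≤h at-s) (g≤h (suc n)) ⟩
  d * prodTo n h * h (suc n)     ≡⟨ *-assoc d _ _ ⟩
  d * (prodTo n h * h (suc n))   ∎
  where open ≤-Reasoning

factor : (ℕ → ℕ) → (ℕ → ℕ) → ℕ → ℕ → ℕ
factor σ E n r with prime? r
... | yes _ = σ r ^ E (val r n)
... | no  _ = 1

reassemble : (ℕ → ℕ) → (ℕ → ℕ) → ℕ → ℕ
reassemble σ E n = ∏[ r ≤ n ] factor σ E n r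

module _ (σ E : ℕ → ℕ) (n : ℕ) where

  factor-prime : ∀ {r} → Prime r → factor σ E n r ≡ σ r ^ E (val r n)
  factor-prime {r} pr with prime? r
  ... | yes _ = refl
  ... | no ¬pr = ⊥-elim (¬pr pr)

  factor>0 : (∀ r → Prime r → 0 < σ r) → ∀ r → 0 < factor σ E n r
  factor>0 σ>0 r with prime? r
  ... | yes pr = ^>0 (E (val r n)) (σ>0 r pr)
  ... | no  _  = ≤-refl

  module _ {s} (ps : Prime s) where

    val-factor-hit : ∀ {r} → Prime r → σ r ≡ s → val s (factor σ E n r) ≡ E (val r n)
    val-factor-hit {r} pr σr≡s rewrite factor-prime pr | σr≡s = val-^ (E (val r n)) (prime⇒1< ps)

    val-factor-miss : (∀ r → Prime r → Prime (σ r)) → ∀ r → ((pr : Prime r) → σ r ≢ s) → val s (factor σ E n r) ≡ 0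
    val-factor-miss σ-prime r miss with prime? r
    ... | yes pr = val-^-other (E (val r n)) ps (σ-prime r pr) (miss pr)
    ... | no  _  = val-1 (prime⇒1< ps)

factor-cong : ∀ σ E₁ E₂ n r → (Prime r → E₁ (val r n) ≡ E₂ (val r n)) → factor σ E₁ n r ≡ factor σ E₂ n r
factor-cong σ E₁ E₂ n r E₁≡E₂ with prime? r
... | yes pr = cong (σ r ^_) (E₁≡E₂ pr)
... | no  _  = refl

factor-mono : ∀ σ₁ σ₂ E₁ E₂ n r →
  (Prime r → σ₁ r ≤ σ₂ r × 0 < σ₂ r × E₁ (val r n) ≤ E₂ (val r n)) → factor σ₁ E₁ n r ≤ factor σ₂ E₂ n r
factor-mono σ₁ σ₂ E₁ E₂ n r bounds with prime? r
... | yes pr = let (σ₁≤σ₂ , σ₂>0 , E₁≤E₂) = bounds pr in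
  ≤-trans (^-monoˡ-≤ (E₁ (val r n)) σ₁≤σ₂) (^-monoʳ-≤ (σ₂ r) {{>-nonZero σ₂>0}} E₁≤E₂)
... | no  _  = ≤-refl

-- E 0 ≡ 0 covers the case n < s, where the product stops before the index s.
val-reassemble-fixed : ∀ {σ E n s} → Prime s → (∀ r → Prime r → Prime (σ r)) → σ s ≡ s →
  (∀ r → Prime r → σ r ≡ s → r ≡ s) → E 0 ≡ 0 → 0 < n → val s (reassemble σ E n) ≡ E (val s n)
val-reassemble-fixed {σ} {E} {n} {s} ps σ-prime σs≡s only-s E0≡0 n>0 =
  trans (val-prodTo n ps (factor>0 σ E n (λ r pr → prime⇒0< (σ-prime r pr))))
        (trans (sumTo-single _ s n (prime⇒0< ps) miss beyond) hit)
  where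
  hit : val s (factor σ E n s) ≡ E (val s n)
  hit = val-factor-hit σ E n ps ps σs≡s
  miss : ∀ r → r ≢ s → val s (factor σ E n r) ≡ 0
  miss r r≢s = val-factor-miss σ E n ps σ-prime r (λ pr σr≡s → r≢s (only-s r pr σr≡s))
  beyond : n < s → val s (factor σ E n s) ≡ 0
  beyond n<s = trans hit (trans (cong E (<⇒val≡0 (prime⇒1< ps) n>0 n<s)) E0≡0)

reassemble-id : ∀ {n} → 0 < n → reassemble id id n ≡ n
reassemble-id {n} n>0 = sym (val-injective n>0 (prodTo>0 n (factor>0 id id n (λ _ → prime⇒0<))) (λ s ps →
  sym (val-reassemble-fixed ps (λ _ pr → pr) refl (λ _ _ r≡s → r≡s) refl n>0)))

-- Replacing q by p throughout the tower

module Substitution {p q} (pp : Prime p) (pq : Prime q) (p<q : p < q) where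

  p≢q : p ≢ q
  p≢q = <⇒≢ p<q

  relabel : ℕ → ℕ
  relabel r with r ≟ q
  ... | yes _ = p
  ... | no  _ = r

  relabel-q : relabel q ≡ p
  relabel-q with q ≟ q
  ... | yes _   = refl
  ... | no q≢q = ⊥-elim (q≢q refl)

  relabel-≢ : ∀ {r} → r ≢ q → relabel r ≡ r
  relabel-≢ {r} r≢q with r ≟ q
  ... | yes r≡q = ⊥-elim (r≢q r≡q)
  ... | no  _   = refl

  relabel-prime : ∀ r → Prime r → Prime (relabel r)
  relabel-prime r pr with r ≟ q
  ... | yes _ = pp
  ... | no  _ = pr

  relabel≤ : ∀ r → relabel r ≤ r
  relabel≤ r with r ≟ q
  ... | yes refl = <⇒≤ p<q
  ... | no  _    = ≤-refl

  relabel≢q : ∀ r → relabel r ≢ q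
  relabel≢q r with r ≟ q
  ... | yes _   = p≢q
  ... | no r≢q  = r≢q

  private
    ψFuel : ℕ → ℕ → ℕ
    ψFuel f       zero    = 0
    ψFuel zero    (suc _) = 1
    ψFuel (suc f) (suc m) = reassemble relabel (ψFuel f) (suc m)

    ψFuel-irrelevant : ∀ f g e → e ≤ f → e ≤ g → ψFuel f e ≡ ψFuel g e
    ψFuel-irrelevant f g zero _ _ = refl
    ψFuel-irrelevant (suc f) (suc g) (suc m) (s≤s m≤f) (s≤s m≤g) =
      prodTo-cong (suc m) λ r _ _ → factor-cong relabel (ψFuel f) (ψFuel g) (suc m) r λ pr →
        let v≤m = ≤-pred (val<n (prime⇒1< pr) (s≤s z≤n)) in
        ψFuel-irrelevant f g (val r (suc m)) (≤-trans v≤m m≤f) (≤-trans v≤m m≤g)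

  ψ : ℕ → ℕ
  ψ n = ψFuel n n

  ψ-unfold : ∀ {n} → 0 < n → ψ n ≡ reassemble relabel ψ n
  ψ-unfold {suc m} _ = prodTo-cong (suc m) λ r _ _ → factor-cong relabel (ψFuel m) ψ (suc m) r λ pr →
    ψFuel-irrelevant m (val r (suc m)) (val r (suc m)) (≤-pred (val<n (prime⇒1< pr) (s≤s z≤n))) ≤-refl

  ψ-factor>0 : ∀ n r → 0 < factor relabel ψ n r
  ψ-factor>0 n = factor>0 relabel ψ n (λ r pr → prime⇒0< (relabel-prime r pr))

  ψ>0 : ∀ {n} → 0 < n → 0 < ψ n
  ψ>0 {n} n>0 = subst (0 <_) (sym (ψ-unfold n>0)) (prodTo>0 n (ψ-factor>0 n))

  ψ≡0⇒ : ∀ {n} → ψ n ≡ 0 → n ≡ 0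
  ψ≡0⇒ {zero}  _     = refl
  ψ≡0⇒ {suc n} ψn≡0 = ⊥-elim (<⇒≢ (ψ>0 {suc n} (s≤s z≤n)) (sym ψn≡0))

  ψ≤ : ∀ n → ψ n ≤ n
  ψ≤ = <-rec (λ n → ψ n ≤ n) step
    where
    step : ∀ n → (∀ {m} → m < n → ψ m ≤ m) → ψ n ≤ n
    step zero      _   = z≤n
    step n@(suc _) rec = begin
      ψ n                      ≡⟨ ψ-unfold {n} (s≤s z≤n) ⟩
      reassemble relabel ψ n   ≤⟨ prodTo-mono n (λ r → factor-mono relabel id ψ id n r λ pr →
                                    relabel≤ r , prime⇒0< pr , rec (val<n (prime⇒1< pr) (s≤s z≤n))) ⟩
      reassemble id id n       ≡⟨ reassemble-id (s≤s z≤n) ⟩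
      n                        ∎
      where open ≤-Reasoning

  val-ψ : ∀ {s n} → Prime s → 0 < n → val s (ψ n) ≡ ∑[ r ≤ n ] val s (factor relabel ψ n r)
  val-ψ {s} {n} ps n>0 = trans (cong (val s) (ψ-unfold n>0)) (val-prodTo n ps (ψ-factor>0 n))

  val-ψ-other : ∀ {s n} → Prime s → s ≢ p → s ≢ q → 0 < n → val s (ψ n) ≡ ψ (val s n)
  val-ψ-other {s} ps s≢p s≢q n>0 = trans (cong (val s) (ψ-unfold n>0))
    (val-reassemble-fixed ps relabel-prime (relabel-≢ s≢q) only-s refl n>0)
    where
    only-s : ∀ r → Prime r → relabel r ≡ s → r ≡ s
    only-s r _ relabel-r≡s with r ≟ q
    ... | yes _ = ⊥-elim (s≢p (sym relabel-r≡s))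
    ... | no  _ = relabel-r≡s

  val-ψ-q : ∀ {n} → 0 < n → val q (ψ n) ≡ 0
  val-ψ-q {n} n>0 = trans (val-ψ pq n>0) (sumTo-zero _ n λ r _ _ →
    val-factor-miss relabel ψ n pq relabel-prime r (λ _ → relabel≢q r))

  val-ψ-p : ∀ {n} → 0 < n → val p (ψ n) ≡ ψ (val p n) + ψ (val q n)
  val-ψ-p {n} n>0 = trans (val-ψ pp n>0)
    (trans (sumTo-pair term p q n (prime⇒0< pp) (prime⇒0< pq) p≢q miss (beyond pp at-p) (beyond pq at-q))
           (cong₂ _+_ at-p at-q))
    where
    term : ℕ → ℕ
    term r = val p (factor relabel ψ n r)
    at-p : term p ≡ ψ (val p n)
    at-p = val-factor-hit relabel ψ n pp pp (relabel-≢ p≢q)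
    at-q : term q ≡ ψ (val q n)
    at-q = val-factor-hit relabel ψ n pp pq relabel-q
    miss : ∀ r → r ≢ p → r ≢ q → term r ≡ 0
    miss r r≢p r≢q = val-factor-miss relabel ψ n pp relabel-prime r
      (λ _ relabel-r≡p → r≢p (trans (sym (relabel-≢ r≢q)) relabel-r≡p))
    beyond : ∀ {t} → Prime t → term t ≡ ψ (val t n) → n < t → term t ≡ 0
    beyond pt at-t n<t = trans at-t (cong ψ (<⇒val≡0 (prime⇒1< pt) n>0 n<t))

  1<p = prime⇒1< pp
  1<q = prime⇒1< pq

  ∉Mp⇒val-p≡0 : ∀ {a} → ¬ InM p a → 0 < a → val p a ≡ 0
  ∉Mp⇒val-p≡0 {a} a∉ a>0 with val p a in v≡
  ... | zero  = refl
  ... | suc _ = ⊥-elim (a∉ (InM⁺ a>0 pp (val>0⇒∣ 1<p a>0 (subst (0 <_) (sym v≡) (s≤s z≤n))) (inj₁ refl)))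

  ∉Mp-val : ∀ {a r} → ¬ InM p a → 0 < a → Prime r → ¬ InM p (val r a)
  ∉Mp-val {a} {r} a∉ a>0 pr v∈ =
    a∉ (InM⁺ a>0 pr (val>0⇒∣ (prime⇒1< pr) a>0 (≤-trans (prime⇒0< pp) (InM⇒≤ v∈))) (inj₂ v∈))

  val-p-ψ≡ψ-val-q : ∀ {a} → ¬ InM p a → 0 < a → val p (ψ a) ≡ ψ (val q a)
  val-p-ψ≡ψ-val-q {a} a∉ a>0 = trans (val-ψ-p a>0) (cong (λ v → ψ v + ψ (val q a)) (∉Mp⇒val-p≡0 a∉ a>0))

  ψ-val≤val-relabel-ψ : ∀ {n r} → 0 < n → Prime r → ψ (val r n) ≤ val (relabel r) (ψ n)
  ψ-val≤val-relabel-ψ {n} {r} n>0 pr with r ≟ q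
  ... | yes refl = subst (ψ (val q n) ≤_) (sym (val-ψ-p n>0)) (m≤n+m _ _)
  ... | no r≢q with r ≟ p
  ...   | yes refl = subst (ψ (val p n) ≤_) (sym (val-ψ-p n>0)) (m≤m+n _ _)
  ...   | no r≢p   = ≤-reflexive (sym (val-ψ-other pr r≢p r≢q n>0))

  ψ≡1⇒ : ∀ {n} → ψ n ≡ 1 → n ≡ 1
  ψ≡1⇒ {suc zero}    _     = refl
  ψ≡1⇒ {suc (suc m)} ψn≡1 with prime-factor {suc (suc m)} (s≤s (s≤s z≤n))
  ... | r , pr , r∣n = ⊥-elim (<⇒≱
    (≤-trans (ψ>0 (∣⇒val>0 (prime⇒1< pr) (s≤s z≤n) r∣n)) (ψ-val≤val-relabel-ψ (s≤s z≤n) pr))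
    (≤-reflexive (trans (cong (val (relabel r)) ψn≡1) (val-1 (prime⇒1< (relabel-prime r pr))))))

  ψ-injective : ∀ {a b} → ¬ InM p a → ¬ InM p b → ψ a ≡ ψ b → a ≡ b
  ψ-injective {a} = <-rec (λ a → ∀ {b} → ¬ InM p a → ¬ InM p b → ψ a ≡ ψ b → a ≡ b) step a
    where
    step : ∀ a → (∀ {a′} → a′ < a → ∀ {b} → ¬ InM p a′ → ¬ InM p b → ψ a′ ≡ ψ b → a′ ≡ b) →
           ∀ {b} → ¬ InM p a → ¬ InM p b → ψ a ≡ ψ b → a ≡ b
    step zero    _ {b}    _ _ ψa≡ψb = sym (ψ≡0⇒ (sym ψa≡ψb))
    step (suc a) _ {zero} _ _ ψa≡ψb = ψ≡0⇒ ψa≡ψb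
    step A@(suc _) rec {B@(suc _)} A∉ B∉ ψA≡ψB = val-injective (s≤s z≤n) (s≤s z≤n) same
      where
      recurse : ∀ {s} → Prime s → ψ (val s A) ≡ ψ (val s B) → val s A ≡ val s B
      recurse ps = rec (val<n (prime⇒1< ps) (s≤s z≤n)) (∉Mp-val A∉ (s≤s z≤n) ps) (∉Mp-val B∉ (s≤s z≤n) ps)
      same : ∀ s → Prime s → val s A ≡ val s B
      same s ps with s ≟ p
      ... | yes refl = trans (∉Mp⇒val-p≡0 A∉ (s≤s z≤n)) (sym (∉Mp⇒val-p≡0 B∉ (s≤s z≤n)))
      ... | no s≢p with s ≟ q
      ...   | yes refl = recurse pq (begin
        ψ (val q A)   ≡⟨ sym (val-p-ψ≡ψ-val-q A∉ (s≤s z≤n)) ⟩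
        val p (ψ A)   ≡⟨ cong (val p) ψA≡ψB ⟩
        val p (ψ B)   ≡⟨ val-p-ψ≡ψ-val-q B∉ (s≤s z≤n) ⟩
        ψ (val q B)   ∎)
        where open ≡-Reasoning
      ...   | no s≢q   = recurse ps (begin
        ψ (val s A)   ≡⟨ sym (val-ψ-other ps s≢p s≢q (s≤s z≤n)) ⟩
        val s (ψ A)   ≡⟨ cong (val s) ψA≡ψB ⟩
        val s (ψ B)   ≡⟨ val-ψ-other ps s≢p s≢q (s≤s z≤n) ⟩
        ψ (val s B)   ∎)
        where open ≡-Reasoning

  q∣⇒p∣ψ : ∀ {a} → ¬ InM p a → 0 < a → q ∣ a → p ∣ ψ a
  q∣⇒p∣ψ a∉ a>0 q∣a = val>0⇒∣ 1<p (ψ>0 a>0)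
    (subst (0 <_) (sym (val-p-ψ≡ψ-val-q a∉ a>0)) (ψ>0 (∣⇒val>0 1<q a>0 q∣a)))

  ψ-∉Mq : ∀ {a} → ¬ InM p a → ¬ InM q (ψ a)
  ψ-∉Mq {a} = <-rec (λ a → ¬ InM p a → ¬ InM q (ψ a)) step a
    where
    step : ∀ a → (∀ {b} → b < a → ¬ InM p b → ¬ InM q (ψ b)) → ¬ InM p a → ¬ InM q (ψ a)
    step zero    _   _  (∈M ())
    step a@(suc _) rec a∉ ψa∈ with InM⁻ ψa∈
    ... | r , pr , r∣ψa , inj₁ refl = <⇒≢ (∣⇒val>0 1<q (ψ>0 {a} (s≤s z≤n)) r∣ψa) (sym (val-ψ-q {a} (s≤s z≤n)))
    ... | r , pr , r∣ψa , inj₂ v∈ with r ≟ q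
    ...   | yes r≡q = 0∉M (subst (InM q) (val-ψ-q {a} (s≤s z≤n)) (subst (λ r → InM q (val r (ψ a))) r≡q v∈))
    ...   | no r≢q with r ≟ p
    ...     | yes r≡p = rec (val<n 1<q (s≤s z≤n)) (∉Mp-val a∉ (s≤s z≤n) pq)
                            (subst (InM q) (val-p-ψ≡ψ-val-q a∉ (s≤s z≤n)) (subst (λ r → InM q (val r (ψ a))) r≡p v∈))
    ...     | no r≢p   = rec (val<n (prime⇒1< pr) (s≤s z≤n)) (∉Mp-val a∉ (s≤s z≤n) pr)
                             (subst (InM q) (val-ψ-other pr r≢p r≢q (s≤s z≤n)) v∈)

  ψ-Mq⇒Mp : ∀ {a} → ¬ InM p a → InM q a → InM p (ψ a)
  ψ-Mq⇒Mp {a} = <-rec (λ a → ¬ InM p a → InM q a → InM p (ψ a)) step a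
    where
    step : ∀ a → (∀ {b} → b < a → ¬ InM p b → InM q b → InM p (ψ b)) → ¬ InM p a → InM q a → InM p (ψ a)
    step a rec a∉ a∈ with InM⁻ a∈
    ... | r , pr , r∣a , inj₁ refl = InM⁺ (ψ>0 a>0) pp (q∣⇒p∣ψ a∉ a>0 r∣a) (inj₁ refl)
      where a>0 = InM⇒0< a∈
    ... | r , pr , r∣a , inj₂ v∈ with r ≟ q
    ...   | yes refl = InM⁺ (ψ>0 a>0) pp (q∣⇒p∣ψ a∉ a>0 r∣a) (inj₁ refl)
      where a>0 = InM⇒0< a∈
    ...   | no r≢q with r ≟ p
    ...     | yes refl = ⊥-elim (<⇒≢ (∣⇒val>0 1<p a>0 r∣a) (sym (∉Mp⇒val-p≡0 a∉ a>0)))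
      where a>0 = InM⇒0< a∈
    ...     | no r≢p   = InM⁺ (ψ>0 a>0) pr
      (val>0⇒∣ (prime⇒1< pr) (ψ>0 a>0) (subst (0 <_) (sym ψ-exp) (ψ>0 (∣⇒val>0 (prime⇒1< pr) a>0 r∣a))))
      (inj₂ (subst (InM p) (sym ψ-exp) (rec (val<n (prime⇒1< pr) a>0) (∉Mp-val a∉ a>0 pr) v∈)))
      where
      a>0 = InM⇒0< a∈
      ψ-exp = val-ψ-other pr r≢p r≢q a>0

  -- If q divides a exactly once, ψ trades that factor q for p and shrinks every other factor.
  val-p-ψ≡1⇒q*ψ≤p*a : ∀ {a} → ¬ InM p a → 0 < a → val p (ψ a) ≡ 1 → q * ψ a ≤ p * a
  val-p-ψ≡1⇒q*ψ≤p*a {a} a∉ a>0 val-p-ψ≡1 =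
    subst₂ (λ x y → q * x ≤ p * y) (sym (ψ-unfold a>0)) (reassemble-id a>0)
      (prodTo-mono-at a q q p (prime⇒0< pq) (∣⇒≤′ a>0 q∣a) termwise (≤-reflexive at-q))
    where
    val-q≡1 : val q a ≡ 1
    val-q≡1 = ψ≡1⇒ (trans (sym (val-p-ψ≡ψ-val-q a∉ a>0)) val-p-ψ≡1)
    q∣a : q ∣ a
    q∣a = val>0⇒∣ 1<q a>0 (≤-reflexive (sym val-q≡1))
    termwise : ∀ r → factor relabel ψ a r ≤ factor id id a r
    termwise r = factor-mono relabel id ψ id a r λ pr → relabel≤ r , prime⇒0< pr , ψ≤ (val r a)
    at-q : q * factor relabel ψ a q ≡ p * factor id id a q
    at-q = begin
      q * factor relabel ψ a q       ≡⟨ cong (q *_) (factor-prime relabel ψ a pq) ⟩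
      q * relabel q ^ ψ (val q a)    ≡⟨ cong₂ (λ x y → q * x ^ ψ y) relabel-q val-q≡1 ⟩
      q * (p * 1)                    ≡⟨ cong (q *_) (*-identityʳ p) ⟩
      q * p                          ≡⟨ *-comm q p ⟩
      p * q                          ≡⟨ cong (p *_) (sym (*-identityʳ q)) ⟩
      p * q ^ 1                      ≡⟨ cong (λ e → p * q ^ e) (sym val-q≡1) ⟩
      p * q ^ val q a                ≡⟨ cong (p *_) (sym (factor-prime id id a pq)) ⟩
      p * factor id id a q           ∎
      where open ≡-Reasoning

-- Counting by injections

elemsTo : ℕ → (ℕ → Bool) → List ℕ
elemsTo zero    P = []
elemsTo (suc N) P = if P (suc N) then suc N ∷ elemsTo N P else elemsTo N P

length-elemsTo : ∀ N P → length (elemsTo N P) ≡ ∑[ n ≤ N ] 𝟙 (P n)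
length-elemsTo zero    P = refl
length-elemsTo (suc N) P with P (suc N)
... | true  = trans (cong suc (length-elemsTo N P)) (+-comm 1 _)
... | false = trans (length-elemsTo N P) (sym (+-identityʳ _))

∈-elemsTo⁻ : ∀ {x} N P → x ∈ elemsTo N P → 0 < x × x ≤ N × T (P x)
∈-elemsTo⁻ (suc N) P x∈ with P (suc N) in P[1+N]
∈-elemsTo⁻ (suc N) P (here refl) | true = s≤s z≤n , ≤-refl , subst T (sym P[1+N]) tt
∈-elemsTo⁻ (suc N) P (there x∈) | true = let (x>0 , x≤N , Px) = ∈-elemsTo⁻ N P x∈ in x>0 , m≤n⇒m≤1+n x≤N , Px
∈-elemsTo⁻ (suc N) P x∈         | false = let (x>0 , x≤N , Px) = ∈-elemsTo⁻ N P x∈ in x>0 , m≤n⇒m≤1+n x≤N , Px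

∈-elemsTo⁺ : ∀ {x} N P → 0 < x → x ≤ N → T (P x) → x ∈ elemsTo N P
∈-elemsTo⁺ {suc _} zero P _ () _
∈-elemsTo⁺ {x} (suc N) P x>0 x≤1+N Px with x ≟ suc N | P (suc N) in P[1+N]
... | yes refl | true  = here refl
... | yes refl | false = ⊥-elim (subst T P[1+N] Px)
... | no x≢1+N | true  = there (∈-elemsTo⁺ N P x>0 (≤-pred (≤∧≢⇒< x≤1+N x≢1+N)) Px)
... | no x≢1+N | false = ∈-elemsTo⁺ N P x>0 (≤-pred (≤∧≢⇒< x≤1+N x≢1+N)) Px

elemsTo-unique : ∀ N P → Unique (elemsTo N P)
elemsTo-unique zero    P = []
elemsTo-unique (suc N) P with P (suc N)
... | true  = All.tabulate (λ x∈ 1+N≡x → 1+n≰n (subst (_≤ N) (sym 1+N≡x) (proj₁ (proj₂ (∈-elemsTo⁻ N P x∈)))))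
              ∷ elemsTo-unique N P
... | false = elemsTo-unique N P

Unique-map⁺ : ∀ {f : ℕ → ℕ} {xs} → Unique xs → (∀ {x y} → x ∈ xs → y ∈ xs → f x ≡ f y → x ≡ y) →
              Unique (map f xs)
Unique-map⁺ []          _   = []
Unique-map⁺ (x∉ ∷ uniq) inj =
  All.map⁺ (All.tabulate (λ y∈ fx≡fy → All.lookup x∉ y∈ (inj (here refl) (there y∈) fx≡fy)))
  ∷ Unique-map⁺ uniq (λ x∈ y∈ → inj (there x∈) (there y∈))

∈-─⁺ : ∀ {x z} {ys : List ℕ} (x∈ys : x ∈ ys) → z ∈ ys → z ≢ x → z ∈ ys ─ x∈ys
∈-─⁺ (here refl) (here refl) z≢x = ⊥-elim (z≢x refl)
∈-─⁺ (here refl) (there z∈)  _   = z∈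
∈-─⁺ (there _)   (here refl) _   = here refl
∈-─⁺ (there x∈)  (there z∈)  z≢x = there (∈-─⁺ x∈ z∈ z≢x)

Unique⇒length≤ : ∀ {xs ys : List ℕ} → Unique xs → xs ⊆ ys → length xs ≤ length ys
Unique⇒length≤                 []         _   = z≤n
Unique⇒length≤ {x ∷ xs} {ys} (x∉ ∷ uniq) xs⊆ys =
  subst (suc (length xs) ≤_) (sym (length-removeAt′ ys (index x∈ys)))
        (s≤s (Unique⇒length≤ uniq (λ z∈ → ∈-─⁺ x∈ys (xs⊆ys (there z∈)) (≢-sym (All.lookup x∉ z∈)))))
  where x∈ys = xs⊆ys (here refl)

-- A sieve for the multipliers k

4*[1+K]*K≤[1+K]^q : ∀ K q → 0 < K → 3 ≤ q → 4 * (suc K * K) ≤ suc K ^ q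
4*[1+K]*K≤[1+K]^q K@(suc t) q _ 3≤q = begin
  4 * (r * K)            ≡⟨ reorder r t ⟩
  r * (4 * (1 + t))      ≤⟨ *-monoʳ-≤ r (≤-trans (m≤m+n _ (t * t)) (≤-reflexive (square t))) ⟩
  r * (r * r)            ≡⟨ cong (λ z → r * (r * z)) (sym (*-identityʳ r)) ⟩
  r ^ 3                  ≤⟨ ^-monoʳ-≤ r 3≤q ⟩
  r ^ q                  ∎
  where
  open ≤-Reasoning
  r = suc K
  reorder : ∀ r t → 4 * (r * suc t) ≡ r * (4 * (1 + t))
  reorder = solve-∀
  square : ∀ t → 4 * (1 + t) + t * t ≡ suc (suc t) * suc (suc t)
  square = solve-∀

𝟙≤𝟙[∧≟0]+𝟙* : ∀ b m → 𝟙 b * 1 ≤ 𝟙 (b ∧ does (m ≟ 0)) + 𝟙 b * m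
𝟙≤𝟙[∧≟0]+𝟙* false m       = z≤n
𝟙≤𝟙[∧≟0]+𝟙* true  zero    = s≤s z≤n
𝟙≤𝟙[∧≟0]+𝟙* true  (suc m) = s≤s z≤n

𝟙[∧]≤𝟙ʳ : ∀ a b → 𝟙 (a ∧ b) ≤ 𝟙 b
𝟙[∧]≤𝟙ʳ false b = z≤n
𝟙[∧]≤𝟙ʳ true  b = ≤-refl

𝟙*≤ : ∀ b x → 𝟙 b * x ≤ x
𝟙*≤ true  x = ≤-reflexive (+-identityʳ x)
𝟙*≤ false x = z≤n

m*c≤L+m⇒m*[c∸1]≤L : ∀ {m c L} → m * c ≤ L + m → m * (c ∸ 1) ≤ L
m*c≤L+m⇒m*[c∸1]≤L {m} {c} {L} mc≤L+m = begin
  m * (c ∸ 1)    ≡⟨ *-distribˡ-∸ m c 1 ⟩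
  m * c ∸ m * 1  ≤⟨ ∸-monoˡ-≤ (m * 1) mc≤L+m ⟩
  L + m ∸ m * 1  ≡⟨ cong (L + m ∸_) (*-identityʳ m) ⟩
  L + m ∸ m      ≡⟨ m+n∸n≡m L m ⟩
  L              ∎
  where open ≤-Reasoning

-- Scaling c ≤ L/m + 1 by 24, using m ≥ j and w = 24/j.
24*c≤w*L+24 : ∀ {m c L} j w → j ≤ m → w * j ≡ 24 → m * c ≤ L + m → 24 * c ≤ w * L + 24
24*c≤w*L+24 {m} {c} {L} j w j≤m w*j≡24 mc≤L+m = begin
  24 * c                      ≤⟨ *-monoʳ-≤ 24 (m≤n+m∸n c 1) ⟩
  24 * (1 + (c ∸ 1))          ≡⟨ *-distribˡ-+ 24 1 (c ∸ 1) ⟩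
  24 + 24 * (c ∸ 1)           ≡⟨ +-comm 24 _ ⟩
  24 * (c ∸ 1) + 24           ≡⟨ cong (λ z → z * (c ∸ 1) + 24) (sym w*j≡24) ⟩
  w * j * (c ∸ 1) + 24        ≡⟨ cong (_+ 24) (*-assoc w j (c ∸ 1)) ⟩
  w * (j * (c ∸ 1)) + 24      ≤⟨ +-monoˡ-≤ 24 (*-monoʳ-≤ w (≤-trans (*-monoˡ-≤ (c ∸ 1) j≤m) (m*c≤L+m⇒m*[c∸1]≤L mc≤L+m))) ⟩
  w * L + 24                  ∎
  where open ≤-Reasoning

overhead : ℕ → ℕ → ℕ
overhead p q = 48 * p * q * (48 * q) + 98 * p * q

module Sieve {p q} (pp : Prime p) (pq : Prime q) (p<q : p < q) (N : ℕ) where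

  instance
    p-nonZero : NonZero p
    p-nonZero = prime⇒nonZero pp
    q-nonZero : NonZero q
    q-nonZero = prime⇒nonZero pq

  X Y L K : ℕ
  X = N / q
  Y = N / p
  L = Y ∸ X
  -- Powers r^q with r > K are counted among all of [1, Y], costing at most Y / K ≤ N / (48 p q).
  K = 48 * q

  X≤Y : X ≤ Y
  X≤Y = /-monoʳ-≤ N (<⇒≤ p<q)

  3≤q : 3 ≤ q
  3≤q = ≤-trans (s≤s (prime⇒1< pp)) p<q

  K>0 : 0 < K
  K>0 = ≤-trans (prime⇒0< pq) (m≤m+n q _)

  -- r = p is left out: a good k is prime to p anyway, and the removed share must stay below 1 when p = 2.
  powerDivides : ℕ → ℕ → Bool
  powerDivides r k = does (1 <? r) ∧ not (does (r ≟ p)) ∧ does (r ^ q ∣? k)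

  badness : ℕ → ℕ
  badness k = 𝟙 (does (p ∣? k)) + 𝟙 (does (q ∣? k)) + ∑[ r ≤ Y ] 𝟙 (powerDivides r k)

  good : ℕ → Bool
  good k = does (X <? k) ∧ does (badness k ≟ 0)

  goodCount : ℕ
  goodCount = ∑[ k ≤ Y ] 𝟙 (good k)

  multiplesBetween : ℕ → ℕ
  multiplesBetween d = ∑[ X < k ≤ Y ] 𝟙 (does (d ∣? k))

  powerCount : ℕ → ℕ
  powerCount r = ∑[ X < k ≤ Y ] 𝟙 (powerDivides r k)

  badness-between : ∑[ X < k ≤ Y ] badness k ≡ multiplesBetween p + multiplesBetween q + ∑[ r ≤ Y ] powerCount r
  badness-between = begin
    ∑[ X < k ≤ Y ] badness k
      ≡⟨ sumTo-cong Y (λ k _ _ → trans (*-distribˡ-+ (𝟙 (does (X <? k))) _ _)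
            (cong₂ _+_ (*-distribˡ-+ (𝟙 (does (X <? k))) _ _) (sym (sumTo-* (𝟙 (does (X <? k))) (λ r → 𝟙 (powerDivides r k)) Y)))) ⟩
    ∑[ k ≤ Y ] (𝟙 (does (X <? k)) * 𝟙 (does (p ∣? k)) + 𝟙 (does (X <? k)) * 𝟙 (does (q ∣? k))
                + ∑[ r ≤ Y ] (𝟙 (does (X <? k)) * 𝟙 (powerDivides r k)))
      ≡⟨ trans (sumTo-+ _ _ Y) (cong₂ _+_ (sumTo-+ _ _ Y) (sumTo-swap (λ k r → 𝟙 (does (X <? k)) * 𝟙 (powerDivides r k)) Y Y)) ⟩
    multiplesBetween p + multiplesBetween q + ∑[ r ≤ Y ] powerCount r ∎
    where open ≡-Reasoning

  sieve : L ≤ goodCount + (multiplesBetween p + multiplesBetween q + ∑[ r ≤ Y ] powerCount r)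
  sieve = begin
    L                                                              ≡⟨ sym (sumBetween-const X≤Y) ⟩
    ∑[ X < _ ≤ Y ] 1                                               ≤⟨ sumTo-mono Y (λ k _ _ → 𝟙≤𝟙[∧≟0]+𝟙* (does (X <? k)) (badness k)) ⟩
    ∑[ k ≤ Y ] (𝟙 (good k) + 𝟙 (does (X <? k)) * badness k)        ≡⟨ sumTo-+ _ _ Y ⟩
    goodCount + ∑[ X < k ≤ Y ] badness k                           ≡⟨ cong (goodCount +_) badness-between ⟩
    goodCount + (multiplesBetween p + multiplesBetween q + ∑[ r ≤ Y ] powerCount r)  ∎
    where open ≤-Reasoning

  powerCount-≤1 : ∀ r → r ≤ 1 → powerCount r ≡ 0
  powerCount-≤1 r r≤1 = sumTo-zero _ Y λ k _ _ → trans
    (cong (λ b → 𝟙 (does (X <? k)) * 𝟙 (b ∧ not (does (r ≟ p)) ∧ does (r ^ q ∣? k))) (dec-false (1 <? r) (≤⇒≯ r≤1)))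
    (*-zeroʳ (𝟙 (does (X <? k))))

  powerCount-p : powerCount p ≡ 0
  powerCount-p = sumTo-zero _ Y λ k _ _ → trans
    (cong₂ (λ a b → 𝟙 (does (X <? k)) * 𝟙 (a ∧ not b ∧ does (p ^ q ∣? k))) (dec-true (1 <? p) (prime⇒1< pp)) (dec-true (p ≟ p) refl))
    (*-zeroʳ (𝟙 (does (X <? k))))

  r^q*powerCount≤ : ∀ r → 1 < r → r ^ q * powerCount r ≤ L + r ^ q × r ^ q * powerCount r ≤ Y
  r^q*powerCount≤ r 1<r =
    ≤-trans (*-monoʳ-≤ (r ^ q) powerCount≤multiplesBetween) (multiples-between r^q>0 X≤Y) ,
    ≤-trans (*-monoʳ-≤ (r ^ q) (≤-trans powerCount≤multiplesBetween (sumTo-mono Y (λ k _ _ → 𝟙*≤ (does (X <? k)) _))))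
            (proj₁ (multiples-bounds Y r^q>0))
    where
    r^q>0 = ^>0 q (<-trans (s≤s z≤n) 1<r)
    powerCount≤multiplesBetween : powerCount r ≤ multiplesBetween (r ^ q)
    powerCount≤multiplesBetween = sumTo-mono Y λ k _ _ → *-monoʳ-≤ (𝟙 (does (X <? k)))
      (≤-trans (𝟙[∧]≤𝟙ʳ (does (1 <? r)) (not (does (r ≟ p)) ∧ does (r ^ q ∣? k))) (𝟙[∧]≤𝟙ʳ (not (does (r ≟ p))) _))

  excess : ℕ
  excess = ∑[ r ≤ K ] (powerCount r ∸ 1)

  -- Each power r^q with r ≤ K may hit the interval once more than its share L / r^q.
  head≤excess+K : ∑[ r ≤ K ] powerCount r ≤ excess + K
  head≤excess+K = begin
    ∑[ r ≤ K ] powerCount r                ≤⟨ sumTo-mono K (λ r _ _ → subst (powerCount r ≤_) (+-comm 1 _) (m≤n+m∸n (powerCount r) 1)) ⟩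
    ∑[ r ≤ K ] ((powerCount r ∸ 1) + 1)    ≡⟨ sumTo-+ _ _ K ⟩
    excess + ∑[ _ ≤ K ] 1                  ≡⟨ cong (excess +_) (sumTo-const K) ⟩
    excess + K                             ∎
    where open ≤-Reasoning

  excess-bound : ∀ a → 0 < a → a ≤ K → (∀ r → r ≤ a → powerCount r ≡ 0) → 4 * a * excess ≤ L
  excess-bound a a>0 a≤K vanish = begin
    4 * a * excess                              ≡⟨ cong (_* excess) (*-comm 4 a) ⟩
    a * 4 * excess                              ≡⟨ *-assoc a 4 excess ⟩
    a * (4 * excess)                            ≡⟨ cong (a *_) (sym (sumTo-* 4 (λ r → powerCount r ∸ 1) K)) ⟩
    a * ∑[ r ≤ K ] (4 * (powerCount r ∸ 1))     ≤⟨ telescoping-bound (λ r → 4 * (powerCount r ∸ 1)) L a K a>0 a≤K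
                                                     (λ r r≤a → cong (λ c → 4 * (c ∸ 1)) (vanish r r≤a)) small ⟩
    L                                           ∎
    where
    open ≤-Reasoning
    small : ∀ k → a ≤ k → 4 * (powerCount (suc k) ∸ 1) * (suc k * k) ≤ L
    small k a≤k = begin
      4 * c′ * (suc k * k)      ≡⟨ reorder c′ (suc k * k) ⟩
      c′ * (4 * (suc k * k))    ≤⟨ *-monoʳ-≤ c′ (4*[1+K]*K≤[1+K]^q k q k>0 3≤q) ⟩
      c′ * suc k ^ q            ≡⟨ *-comm c′ _ ⟩
      suc k ^ q * c′            ≤⟨ m*c≤L+m⇒m*[c∸1]≤L (proj₁ (r^q*powerCount≤ (suc k) (s≤s k>0))) ⟩
      L                         ∎
      where
      c′ = powerCount (suc k) ∸ 1
      k>0 = ≤-trans a>0 a≤k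
      reorder : ∀ a b → 4 * a * b ≡ a * (4 * b)
      reorder = solve-∀

  tail : ℕ
  tail = ∑[ K < r ≤ Y + K ] powerCount r

  K*tail≤Y : K * tail ≤ Y
  K*tail≤Y = telescoping-bound (λ r → 𝟙 (does (K <? r)) * powerCount r) Y K (Y + K) K>0 (m≤n+m K Y)
    (λ r r≤K → cong (λ b → 𝟙 b * powerCount r) (dec-false (K <? r) (≤⇒≯ r≤K)))
    λ k K≤k → begin
      𝟙 (does (K <? suc k)) * powerCount (suc k) * (suc k * k) ≤⟨ *-mono-≤ (𝟙*≤ (does (K <? suc k)) _)
                                                                     (≤-trans (m≤n*m _ 4) (4*[1+K]*K≤[1+K]^q k q (≤-trans K>0 K≤k) 3≤q)) ⟩
      powerCount (suc k) * suc k ^ q                           ≡⟨ *-comm (powerCount (suc k)) _ ⟩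
      suc k ^ q * powerCount (suc k)                           ≤⟨ proj₂ (r^q*powerCount≤ (suc k) (s≤s (≤-trans K>0 K≤k))) ⟩
      Y                                                        ∎
    where open ≤-Reasoning

  powerCounts≤ : ∑[ r ≤ Y ] powerCount r ≤ excess + K + tail
  powerCounts≤ = begin
    ∑[ r ≤ Y ] powerCount r                 ≤⟨ sumTo-monoˡ powerCount (m≤m+n Y K) ⟩
    ∑[ r ≤ Y + K ] powerCount r             ≡⟨ sym (sumBetween-split powerCount (m≤n+m K Y)) ⟩
    tail + ∑[ r ≤ K ] powerCount r          ≤⟨ +-monoʳ-≤ tail head≤excess+K ⟩
    tail + (excess + K)                     ≡⟨ +-comm tail _ ⟩
    excess + K + tail                       ∎
    where open ≤-Reasoning

  -- The proportion of the interval removed is at most 1/2 + 1/3 + 1/8 = 23/24 (p = 2) or 1/3 + 1/4 + 1/4 (p ≥ 3).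
  removed-share : 24 * (multiplesBetween p + multiplesBetween q + excess) ≤ 23 * L + 48
  removed-share with p ≟ 2
  ... | yes p≡2 = begin
    24 * (bp + bq + excess)                 ≡⟨ distrib bp bq excess ⟩
    24 * bp + 24 * bq + 3 * (8 * excess)    ≤⟨ +-mono-≤ (+-mono-≤ (24*c≤w*L+24 2 12 (prime⇒1< pp) refl (multiples-between (prime⇒0< pp) X≤Y))
                                                                  (24*c≤w*L+24 3 8 3≤q refl (multiples-between (prime⇒0< pq) X≤Y)))
                                                        (*-monoʳ-≤ 3 (excess-bound 2 (s≤s z≤n) 2≤K vanish)) ⟩
    (12 * L + 24) + (8 * L + 24) + 3 * L    ≡⟨ collect L ⟩
    23 * L + 48                             ∎
    where
    open ≤-Reasoning
    bp = multiplesBetween p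
    bq = multiplesBetween q
    distrib : ∀ a b c → 24 * (a + b + c) ≡ 24 * a + 24 * b + 3 * (8 * c)
    distrib = solve-∀
    collect : ∀ L → (12 * L + 24) + (8 * L + 24) + 3 * L ≡ 23 * L + 48
    collect = solve-∀
    2≤K = ≤-trans (s≤s (s≤s z≤n)) (m≤m*n 48 q)
    vanish : ∀ r → r ≤ 2 → powerCount r ≡ 0
    vanish r r≤2 with r ≤? 1
    ... | yes r≤1 = powerCount-≤1 r r≤1
    ... | no  r≰1 = trans (cong powerCount (trans (≤-antisym r≤2 (≰⇒> r≰1)) (sym p≡2))) powerCount-p
  ... | no p≢2 = begin
    24 * (bp + bq + excess)                 ≡⟨ distrib bp bq excess ⟩
    24 * bp + 24 * bq + 6 * (4 * 1 * excess) ≤⟨ +-mono-≤ (+-mono-≤ (24*c≤w*L+24 3 8 3≤p refl (multiples-between (prime⇒0< pp) X≤Y))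
                                                                  (24*c≤w*L+24 4 6 (≤-trans (s≤s 3≤p) p<q) refl (multiples-between (prime⇒0< pq) X≤Y)))
                                                        (*-monoʳ-≤ 6 (excess-bound 1 (s≤s z≤n) K>0 powerCount-≤1)) ⟩
    (8 * L + 24) + (6 * L + 24) + 6 * L     ≡⟨ collect L ⟩
    20 * L + 48                             ≤⟨ +-monoˡ-≤ 48 (*-monoˡ-≤ L (m≤m+n 20 3)) ⟩
    23 * L + 48                             ∎
    where
    open ≤-Reasoning
    bp = multiplesBetween p
    bq = multiplesBetween q
    3≤p : 3 ≤ p
    3≤p = ≤∧≢⇒< (prime⇒1< pp) (λ 2≡p → p≢2 (sym 2≡p))
    distrib : ∀ a b c → 24 * (a + b + c) ≡ 24 * a + 24 * b + 6 * (4 * 1 * c)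
    distrib = solve-∀
    collect : ∀ L → (8 * L + 24) + (6 * L + 24) + 6 * L ≡ 20 * L + 48
    collect = solve-∀

  L≤ : L ≤ 24 * (goodCount + K + tail) + 48
  L≤ = +-cancelˡ-≤ (23 * L) _ _ (begin
    23 * L + L                                             ≡⟨ split L ⟩
    24 * L                                                 ≤⟨ *-monoʳ-≤ 24 (≤-trans sieve (+-monoʳ-≤ goodCount (+-monoʳ-≤ (bp + bq) powerCounts≤))) ⟩
    24 * (goodCount + (bp + bq + (excess + K + tail)))     ≡⟨ regroup goodCount bp bq excess K tail ⟩
    24 * (bp + bq + excess) + 24 * (goodCount + K + tail)  ≤⟨ +-monoˡ-≤ _ removed-share ⟩
    23 * L + 48 + 24 * (goodCount + K + tail)              ≡⟨ reorder (23 * L) 48 (24 * (goodCount + K + tail)) ⟩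
    23 * L + (24 * (goodCount + K + tail) + 48)            ∎)
    where
    open ≤-Reasoning
    bp = multiplesBetween p
    bq = multiplesBetween q
    split : ∀ L → 23 * L + L ≡ 24 * L
    split = solve-∀
    regroup : ∀ g a b e k t → 24 * (g + (a + b + (e + k + t))) ≡ 24 * (a + b + e) + 24 * (g + k + t)
    regroup = solve-∀
    reorder : ∀ a b c → a + b + c ≡ a + (c + b)
    reorder = solve-∀

  p*Y≤N : p * Y ≤ N
  p*Y≤N = subst (_≤ N) (*-comm Y p) (m/n*n≤m N p)

  N≤p*q*L+p*q : N ≤ p * q * L + p * q
  N≤p*q*L+p*q = ≤-trans (m≤m+n N q) (+-cancelˡ-≤ (p * N) _ _ (begin
    p * N + (N + q)                  ≡⟨ reorder p N q ⟩
    suc p * N + q                    ≤⟨ +-monoˡ-≤ q (*-monoˡ-≤ N p<q) ⟩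
    q * N + q                        ≡⟨ trans (+-comm (q * N) q) (trans (sym (*-suc q N)) (cong (q *_) (+-comm 1 N))) ⟩
    q * (N + 1)                      ≤⟨ *-monoʳ-≤ q (subst (_≤ p * Y + p) (+-comm 1 N) N<p*Y+p) ⟩
    q * (p * Y + p)                  ≡⟨ cong (λ y → q * (p * y + p)) (sym (m∸n+n≡m X≤Y)) ⟩
    q * (p * (L + X) + p)            ≡⟨ expand p q L X ⟩
    p * (q * X) + (p * q * L + p * q) ≤⟨ +-monoˡ-≤ _ (*-monoʳ-≤ p (subst (_≤ N) (*-comm X q) (m/n*n≤m N q))) ⟩
    p * N + (p * q * L + p * q)      ∎))
    where
    open ≤-Reasoning
    reorder : ∀ p N q → p * N + (N + q) ≡ suc p * N + q
    reorder = solve-∀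
    expand : ∀ p q L X → q * (p * (L + X) + p) ≡ p * (q * X) + (p * q * L + p * q)
    expand = solve-∀
    N<p*Y+p : N < p * Y + p
    N<p*Y+p = subst (N <_) (trans (*-suc p Y) (+-comm p (p * Y))) (m<n*[1+m/n] N p)

  N≤48pq*goodCount+overhead : N ≤ 48 * p * q * goodCount + overhead p q
  N≤48pq*goodCount+overhead = +-cancelʳ-≤ N _ _ (begin
    N + N                                                     ≡⟨ cong (N +_) (sym (+-identityʳ N)) ⟩
    2 * N                                                     ≤⟨ *-monoʳ-≤ 2 N≤p*q*L+p*q ⟩
    2 * (p * q * L + p * q)                                   ≤⟨ *-monoʳ-≤ 2 (+-monoˡ-≤ (p * q) (*-monoʳ-≤ (p * q) L≤)) ⟩
    2 * (p * q * (24 * (goodCount + K + tail) + 48) + p * q)  ≡⟨ expand p q goodCount K tail ⟩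
    48 * p * q * goodCount + overhead p q + p * (K * tail)        ≤⟨ +-monoʳ-≤ _ (≤-trans (*-monoʳ-≤ p K*tail≤Y) p*Y≤N) ⟩
    48 * p * q * goodCount + overhead p q + N                     ∎)
    where
    open ≤-Reasoning
    expand : ∀ p q g k t → 2 * (p * q * (24 * (g + 48 * q + t) + 48) + p * q)
                          ≡ 48 * p * q * g + (48 * p * q * (48 * q) + 98 * p * q) + p * (48 * q * t)
    expand = solve-∀

  goodCount-large : 2 * overhead p q ≤ N → N ≤ 96 * p * q * goodCount
  goodCount-large 2*overhead≤N = +-cancelʳ-≤ N _ _ (begin
    N + N                                           ≡⟨ cong (N +_) (sym (+-identityʳ N)) ⟩
    2 * N                                           ≤⟨ *-monoʳ-≤ 2 N≤48pq*goodCount+overhead ⟩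
    2 * (48 * p * q * goodCount + overhead p q)     ≡⟨ expand p q goodCount (overhead p q) ⟩
    96 * p * q * goodCount + 2 * overhead p q       ≤⟨ +-monoʳ-≤ _ 2*overhead≤N ⟩
    96 * p * q * goodCount + N                      ∎)
    where
    open ≤-Reasoning
    expand : ∀ p q g o → 2 * (48 * p * q * g + o) ≡ 96 * p * q * g + 2 * o
    expand = solve-∀

  record Good (k : ℕ) : Set where
    field
      X<k     : X < k
      p∤k     : ¬ p ∣ k
      q∤k     : ¬ q ∣ k
      r^q∤k   : ∀ r → 1 < r → r ≢ p → ¬ r ^ q ∣ k

  good⇒Good : ∀ {k} → 0 < k → k ≤ Y → T (good k) → Good k
  good⇒Good {k} k>0 k≤Y good-k = record
    { X<k   = T-does⁻ (X <? k) (proj₁ parts)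
    ; p∤k   = λ p∣k → absent (≤-reflexive (sym (cong 𝟙 (dec-true (p ∣? k) p∣k))))
                             (≤-trans (m≤m+n _ _) (m≤m+n _ _))
    ; q∤k   = λ q∣k → absent (≤-reflexive (sym (cong 𝟙 (dec-true (q ∣? k) q∣k))))
                             (≤-trans (m≤n+m _ (𝟙 (does (p ∣? k)))) (m≤m+n _ _))
    ; r^q∤k = λ r 1<r r≢p r^q∣k → absent (≤-reflexive (sym (hit r 1<r r≢p r^q∣k)))
                 (≤-trans (term≤sumTo (λ r → 𝟙 (powerDivides r k)) Y r (<-trans (s≤s z≤n) 1<r) (r≤Y r 1<r r^q∣k))
                          (m≤n+m _ _))
    }
    where
    parts = Equivalence.to T-∧ good-k
    absent : ∀ {t} → 1 ≤ t → t ≤ badness k → ⊥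
    absent 1≤t t≤b = <⇒≢ (≤-trans 1≤t t≤b) (sym (T-does⁻ (badness k ≟ 0) (proj₂ parts)))
    hit : ∀ r → 1 < r → r ≢ p → r ^ q ∣ k → 𝟙 (powerDivides r k) ≡ 1
    hit r 1<r r≢p r^q∣k rewrite dec-true (1 <? r) 1<r | dec-false (r ≟ p) r≢p | dec-true (r ^ q ∣? k) r^q∣k = refl
    r≤Y : ∀ r → 1 < r → r ^ q ∣ k → r ≤ Y
    r≤Y r 1<r r^q∣k = begin
      r        ≡⟨ sym (*-identityʳ r) ⟩
      r ^ 1    ≤⟨ ^-monoʳ-≤ r {{>-nonZero (<-trans (s≤s z≤n) 1<r)}} (prime⇒0< pq) ⟩
      r ^ q    ≤⟨ ∣⇒≤′ k>0 r^q∣k ⟩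
      k        ≤⟨ k≤Y ⟩
      Y        ∎
      where open ≤-Reasoning

-- Comparing M(p) and M(q)

T-not⁻ : ∀ {b} → T (not b) → ¬ T b
T-not⁻ {false} _ ()

T-not⁺ : ∀ {b} → ¬ T b → T (not b)
T-not⁺ {true}  ¬b = ¬b tt
T-not⁺ {false} _  = tt

𝟙-split : ∀ x y → 𝟙 x ≡ 𝟙 (x ∧ not y) + 𝟙 (x ∧ y)
𝟙-split true  true  = refl
𝟙-split true  false = refl
𝟙-split false y     = refl

module Comparison {p q} (pp : Prime p) (pq : Prime q) (p<q : p < q) (N : ℕ) where

  open Substitution pp pq p<q
  open Sieve pp pq p<q N using (Y; good; goodCount; Good; good⇒Good; p*Y≤N; goodCount-large; p-nonZero; q-nonZero)

  onlyQ onlyP both : ℕ → Bool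
  onlyQ n = inM q n ∧ not (inM p n)
  onlyP n = inM p n ∧ not (inM q n)
  both  n = inM q n ∧ inM p n

  count : (ℕ → Bool) → ℕ
  count P = ∑[ n ≤ N ] 𝟙 (P n)

  countM-q : countM q N ≡ count onlyQ + count both
  countM-q = trans (countM≡∑ q N) (trans (sumTo-cong N (λ n _ _ → 𝟙-split (inM q n) (inM p n))) (sumTo-+ _ _ N))

  countM-p : countM p N ≡ count onlyP + count both
  countM-p = trans (countM≡∑ p N) (trans (sumTo-cong N (λ n _ _ →
    trans (𝟙-split (inM p n) (inM q n)) (cong (λ b → 𝟙 (onlyP n) + 𝟙 b) (∧-comm (inM p n) (inM q n))))) (sumTo-+ _ _ N))

  onlyQs onlyPs goods : List ℕ
  onlyQs = elemsTo N onlyQ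
  onlyPs = elemsTo N onlyP
  goods  = elemsTo Y good

  val-p[p*k] : ∀ {k} → 0 < k → ¬ p ∣ k → val p (p * k) ≡ 1
  val-p[p*k] {k} k>0 p∤k = trans (val-* pp (prime⇒0< pp) k>0) (cong₂ _+_ val-p-p val-p-k)
    where
    val-p-p : val p p ≡ 1
    val-p-p = trans (cong (val p) (sym (*-identityʳ p))) (val-^ 1 1<p)
    val-p-k : val p k ≡ 0
    val-p-k = val-unique 1<p k>0 (1∣ k) (p∤k ∘′ subst (_∣ k) (*-identityʳ p))

  val-r[p*k] : ∀ {k r} → 0 < k → Prime r → r ≢ p → val r (p * k) ≡ val r k
  val-r[p*k] {k} {r} k>0 pr r≢p = trans (val-* pr (prime⇒0< pp) k>0)
    (cong (_+ val r k) (trans (cong (val r) (sym (*-identityʳ p))) (val-^-other 1 pr pp (≢-sym r≢p))))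

  p*good∈onlyPs : ∀ {k} → k ∈ goods → p * k ∈ onlyPs
  p*good∈onlyPs {k} k∈ = ∈-elemsTo⁺ N onlyP pk>0 (≤-trans (*-monoʳ-≤ p k≤Y) p*Y≤N)
                           (Equivalence.from T-∧ (InM.isInM pk∈Mp , T-not⁺ (pk∉Mq ∘′ ∈M)))
    where
    k>0 = proj₁ (∈-elemsTo⁻ Y good k∈)
    k≤Y = proj₁ (proj₂ (∈-elemsTo⁻ Y good k∈))
    k-good : Good k
    k-good = good⇒Good k>0 k≤Y (proj₂ (proj₂ (∈-elemsTo⁻ Y good k∈)))
    open Good k-good
    pk>0 = *-mono-≤ (prime⇒0< pp) k>0
    pk∈Mp : InM p (p * k)
    pk∈Mp = InM⁺ pk>0 pp (m∣m*n k) (inj₁ refl)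
    pk∉Mq : ¬ InM q (p * k)
    pk∉Mq pk∈ with InM⁻ pk∈
    ... | r , pr , q∣pk , inj₁ refl with euclidsLemma p k pq q∣pk
    ...   | inj₁ q∣p = p≢q (sym (prime∣prime⇒≡ pq pp q∣p))
    ...   | inj₂ q∣k = q∤k q∣k
    pk∉Mq pk∈ | r , pr , r∣pk , inj₂ v∈ with r ≟ p
    ...   | yes refl = <⇒≱ 1<q (subst (q ≤_) (val-p[p*k] k>0 p∤k) (InM⇒≤ v∈))
    ...   | no r≢p   = r^q∤k r (prime⇒1< pr) r≢p
                         (∣-trans (^-monoʳ-∣ r (subst (q ≤_) (val-r[p*k] k>0 pr r≢p) (InM⇒≤ v∈)))
                                  (p^val∣n (prime⇒1< pr) k>0))

  record OnlyQ (a : ℕ) : Set where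
    field
      a>0 : 0 < a
      a≤N : a ≤ N
      a∈Mq : InM q a
      a∉Mp : ¬ InM p a

  onlyQs⇒OnlyQ : ∀ {a} → a ∈ onlyQs → OnlyQ a
  onlyQs⇒OnlyQ {a} a∈ = let (a>0 , a≤N , only) = ∈-elemsTo⁻ N onlyQ a∈
                            (in-q , not-p) = Equivalence.to T-∧ only in
    record { a>0 = a>0 ; a≤N = a≤N ; a∈Mq = ∈M in-q ; a∉Mp = T-not⁻ not-p ∘′ InM.isInM }

  ψ[onlyQ]∈onlyPs : ∀ {a} → a ∈ onlyQs → ψ a ∈ onlyPs
  ψ[onlyQ]∈onlyPs {a} a∈ = ∈-elemsTo⁺ N onlyP (ψ>0 a>0) (≤-trans (ψ≤ a) a≤N)
    (Equivalence.from T-∧ (InM.isInM (ψ-Mq⇒Mp a∉Mp a∈Mq) , T-not⁺ (ψ-∉Mq a∉Mp ∘′ ∈M)))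
    where open OnlyQ (onlyQs⇒OnlyQ a∈)

  -- An image ψ a = p k would have p-valuation 1, hence q p k ≤ p a ≤ p N, contradicting k > N / q.
  ψ[onlyQs]-disjoint : Disjoint (map ψ onlyQs) (map (p *_) goods)
  ψ[onlyQs]-disjoint (x∈ψ , x∈p*) with ∈-map⁻ ψ x∈ψ | ∈-map⁻ (p *_) x∈p*
  ... | a , a∈ , refl | k , k∈ , ψa≡pk = <⇒≱ N<q*k (≤-trans q*k≤a a≤N)
    where
    open OnlyQ (onlyQs⇒OnlyQ a∈)
    k>0 = proj₁ (∈-elemsTo⁻ Y good k∈)
    k-good = good⇒Good k>0 (proj₁ (proj₂ (∈-elemsTo⁻ Y good k∈))) (proj₂ (proj₂ (∈-elemsTo⁻ Y good k∈)))
    N<q*k : N < q * k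
    N<q*k = <-≤-trans (m<n*[1+m/n] N q) (*-monoʳ-≤ q (Good.X<k k-good))
    q*ψa≤p*a = val-p-ψ≡1⇒q*ψ≤p*a a∉Mp a>0 (trans (cong (val p) ψa≡pk) (val-p[p*k] k>0 (Good.p∤k k-good)))
    q*k≤a : q * k ≤ a
    q*k≤a = *-cancelˡ-≤ p (subst (_≤ p * a) (trans (cong (q *_) ψa≡pk) (x∙yz≈y∙xz q p k)) q*ψa≤p*a)
      where
      x∙yz≈y∙xz : ∀ a b c → a * (b * c) ≡ b * (a * c)
      x∙yz≈y∙xz = solve-∀

  count-onlyQ+goodCount≤count-onlyP : count onlyQ + goodCount ≤ count onlyP
  count-onlyQ+goodCount≤count-onlyP = subst₂ _≤_
    (trans (length-++ (map ψ onlyQs)) (cong₂ _+_ (trans (length-map ψ onlyQs) (length-elemsTo N onlyQ))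
                                                (trans (length-map (p *_) goods) (length-elemsTo Y good))))
    (length-elemsTo N onlyP)
    (Unique⇒length≤ unique included)
    where
    unique : Unique (map ψ onlyQs ++ map (p *_) goods)
    unique = Unique.++⁺ (Unique-map⁺ (elemsTo-unique N onlyQ) λ a∈ b∈ →
                           ψ-injective (OnlyQ.a∉Mp (onlyQs⇒OnlyQ a∈)) (OnlyQ.a∉Mp (onlyQs⇒OnlyQ b∈)))
                        (Unique.map⁺ (*-cancelˡ-≡ _ _ p) (elemsTo-unique Y good))
                        ψ[onlyQs]-disjoint
    included : map ψ onlyQs ++ map (p *_) goods ⊆ onlyPs
    included x∈ with ∈-++⁻ (map ψ onlyQs) x∈
    ... | inj₁ x∈ψ with ∈-map⁻ ψ x∈ψ
    ...   | a , a∈ , refl = ψ[onlyQ]∈onlyPs a∈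
    included x∈ | inj₂ x∈p* with ∈-map⁻ (p *_) x∈p*
    ...   | k , k∈ , refl = p*good∈onlyPs k∈

  density-gap : 2 * overhead p q ≤ N → 96 * p * q * countM q N + N ≤ 96 * p * q * countM p N
  density-gap 2*overhead≤N = begin
    c * countM q N + N                            ≤⟨ +-mono-≤ (≤-reflexive (cong (c *_) countM-q)) (goodCount-large 2*overhead≤N) ⟩
    c * (count onlyQ + count both) + c * goodCount ≡⟨ regroup c (count onlyQ) (count both) goodCount ⟩
    c * (count onlyQ + goodCount + count both)     ≤⟨ *-monoʳ-≤ c (+-monoˡ-≤ (count both) count-onlyQ+goodCount≤count-onlyP) ⟩
    c * (count onlyP + count both)                 ≡⟨ cong (c *_) (sym countM-p) ⟩
    c * countM p N                                 ∎
    where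
    open ≤-Reasoning
    c = 96 * p * q
    regroup : ∀ c a b g → c * (a + b) + c * g ≡ c * (a + g + b)
    regroup = solve-∀

density-decreasing : (p q : ℕ) → Prime p → Prime q → p < q → DensityGreater p q
density-decreasing p q pp pq p<q = 0 , 96 * p * q ∸ 1 , 2 * overhead p q , λ N N₀≤N →
  subst₂ (λ c n → c * countM q N + n ≤ c * countM p N) (sym c≡) (sym (+-identityʳ N))
         (Comparison.density-gap pp pq p<q N N₀≤N)
  where
  c≡ : suc (96 * p * q ∸ 1) ≡ 96 * p * q
  c≡ = m+[n∸m]≡n (*-mono-≤ (*-mono-≤ {1} {96} (s≤s z≤n) (prime⇒0< pp)) (prime⇒0< pq))

density→0 : (a b : ℕ) → Σ ℕ λ Q → (q : ℕ) → Prime q → Q ≤ q →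
  Σ ℕ λ N₀ → (N : ℕ) → N₀ ≤ N → suc b * countM q N ≤ suc a * N
density→0 a b = 2 * suc b + 2 , λ q _ Q≤q → 0 , λ N _ →
  ≤-trans (countM-small (suc b) q N Q≤q) (m≤n*m N (suc a))

corollary6 : ((p q : ℕ) → Prime p → Prime q → p < q → DensityGreater p q)
    × ((a b : ℕ) → Σ ℕ λ Q → (q : ℕ) → Prime q → Q ≤ q →
    Σ ℕ λ N₀ → (N : ℕ) → N₀ ≤ N → suc b * countM q N ≤ suc a * N)
corollary6 = density-decreasing , density→0
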